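{- Let $p$ be a prime and $n\ge3$. For every $\sigma\in\mathrm{A}$, the subgroup of $\mathrm{B}^\sigma$ generated by the image of the natural map $(\mathrm{U}^1/(\mathrm{conjugacy}))^\sigma\to\mathrm{B}^\sigma$ contains $\mathrm{B}_0\cap\mathrm{B}^\sigma$.
   Context: $\mathrm{U}$: upper unitriangular $(n+1)\times(n+1)$ matrices over $\mathbf{F}_p$, indices $0,\dots,n$; $e_{i,j}$ the matrix with $1$ at $(i,j)$ and other off-diagonal entries $0$; $\mathrm{U}^m$ the subgroup of matrices with vanishing entries at $(i,j)$ for $0<j-i\le m$; $\mathrm{A}=\mathrm{U}/\mathrm{U}^1$; $\mathrm{B}=\mathrm{U}^1/\mathrm{U}^3$ (abelianization of $\mathrm{U}^1$) with basis the images $\bar e_{i,j}$, $2\le j-i\le3$. $\mathrm{U}^1/(\mathrm{conjugacy})$ is the set of conjugacy classes of $\mathrm{U}^1$; conjugation by $\mathrm{U}$ induces compatible actions of $\mathrm{A}$ on $\mathrm{U}^1/(\mathrm{conjugacy})$ and on $\mathrm{B}$. Superscript $\sigma$ denotes $\sigma$-fixed elements. $\mathrm{B}_0\subseteq\mathrm{B}$ is the subgroup generated by $\bar e_{0,2},\bar e_{0,3},\bar e_{n-3,n},\bar e_{n-2,n}$. -}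

module Defs where

open import Data.Nat as ℕ using (ℕ; zero; suc; _∸_)
open import Data.Integer as ℤ using (ℤ; +_; _-_)
open import Data.Integer.Divisibility using (_∣_)
open import Data.Fin using (Fin; toℕ)
import Data.Fin as Fin
open import Data.List using (List; []; _∷_)
open import Data.List.Relation.Unary.All using (All)
open import Data.Product using (Σ; ∃; _×_; _,_)
open import Relation.Binary.PropositionalEquality using (_≡_)
open import Relation.Nullary.Decidable using (⌊_⌋)
open import Data.Bool using (if_then_else_; _∧_)

-- Congruence modulo p : the field F_p is modelled by ℤ up to ≡ mod p.
infix 4 _≡[_]_ _≈[_]_ _≈B[_]_
infixl 6 _+B_
infixl 7 _·B_ _⊗_

_≡[_]_ : ℤ → ℕ → ℤ → Set
a ≡[ p ] b = (+ p) ∣ (a - b)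

-- (n+1)×(n+1) matrices with integer entries, indices 0..n (read mod p).
Mat : ℕ → Set
Mat n = Fin (suc n) → Fin (suc n) → ℤ

sumFin : ∀ {m} → (Fin m → ℤ) → ℤ
sumFin {zero}  f = + 0
sumFin {suc m} f = f Fin.zero ℤ.+ sumFin (λ k → f (Fin.suc k))

_⊗_ : ∀ {n} → Mat n → Mat n → Mat n
(x ⊗ y) i j = sumFin (λ k → x i k ℤ.* y k j)

_≈[_]_ : ∀ {n} → Mat n → ℕ → Mat n → Set
x ≈[ p ] y = ∀ i j → x i j ≡[ p ] y i j

InU : (p : ℕ) → ∀ {n} → Mat n → Set
InU p g = ∀ i j → (toℕ j ℕ.< toℕ i → g i j ≡[ p ] + 0) × (i ≡ j → g i j ≡[ p ] + 1)

InUm : (p : ℕ) → ∀ {n} → ℕ → Mat n → Set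
InUm p m x = InU p x ×
  (∀ i j → toℕ i ℕ.< toℕ j → toℕ j ∸ toℕ i ℕ.≤ m → x i j ≡[ p ] + 0)

-- Conjugacy in U^1 : x ~ y iff ∃ h ∈ U^1 with h y h⁻¹ = x, i.e. h y = x h.
ConjU1 : (p : ℕ) → ∀ {n} → Mat n → Mat n → Set
ConjU1 p {n} x y = Σ (Mat n) λ h → InUm p 1 h × ((h ⊗ y) ≈[ p ] (x ⊗ h))

-- The conjugacy class of x ∈ U^1 is fixed by σ = image of g ∈ U in A:
-- g x g⁻¹ (the matrix y with y g = g x) is U^1-conjugate to x.
ClassFixed : (p : ℕ) → ∀ {n} → Mat n → Mat n → Set
ClassFixed p {n} g x =
  Σ (Mat n) λ y → InU p y × ((y ⊗ g) ≈[ p ] (g ⊗ x)) × ConjU1 p y x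

-- B = U^1/U^3, with basis ē_{i,j}, 2 ≤ j-i ≤ 3.  An element of B is
-- represented by its coordinate function (only positions 2 ≤ j-i ≤ 3
-- matter); the natural map π : U^1 → B sends x to its entries there.
BPos : ∀ {n} → Fin (suc n) → Fin (suc n) → Set
BPos i j = (2 ℕ.+ toℕ i ℕ.≤ toℕ j) × (toℕ j ℕ.≤ 3 ℕ.+ toℕ i)

_≈B[_]_ : ∀ {n} → Mat n → ℕ → Mat n → Set
b ≈B[ p ] c = ∀ i j → BPos i j → b i j ≡[ p ] c i j

π : ∀ {n} → Mat n → Mat n
π x = x

ebar : ∀ {n} → ℕ → ℕ → Mat n
ebar a c i j = if ⌊ toℕ i ℕ.≟ a ⌋ ∧ ⌊ toℕ j ℕ.≟ c ⌋ then + 1 else + 0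

_+B_ : ∀ {n} → Mat n → Mat n → Mat n
(b +B c) i j = b i j ℤ.+ c i j

_·B_ : ∀ {n} → ℤ → Mat n → Mat n
(k ·B b) i j = k ℤ.* b i j

zeroB : ∀ {n} → Mat n
zeroB i j = + 0

lincomb : ∀ {n} → List (ℤ × Mat n) → Mat n
lincomb []            = zeroB
lincomb ((c , x) ∷ l) = (c ·B π x) +B lincomb l

InB0 : (p : ℕ) → (n : ℕ) → Mat n → Set
InB0 p n b = Σ ℤ λ c₁ → Σ ℤ λ c₂ → Σ ℤ λ c₃ → Σ ℤ λ c₄ →
  b ≈B[ p ] ((c₁ ·B ebar 0 2) +B ((c₂ ·B ebar 0 3) +B
            ((c₃ ·B ebar (n ∸ 3) n) +B (c₄ ·B ebar (n ∸ 2) n))))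

-- b ∈ B^σ (σ = image of g): for a lift x ∈ U^1 of b, σ·b = π(g x g⁻¹) equals b.
InBσ : (p : ℕ) → ∀ {n} → Mat n → Mat n → Set
InBσ p {n} g b = ∀ (x y : Mat n) → InUm p 1 x → π x ≈B[ p ] b →
  (y ⊗ g) ≈[ p ] (g ⊗ x) → π y ≈B[ p ] b

InGenFixed : (p : ℕ) → ∀ {n} → Mat n → Mat n → Set
InGenFixed p {n} g b = Σ (List (ℤ × Mat n)) λ l →
  All (λ cx → let x = Data.Product.proj₂ cx in InUm p 1 x × ClassFixed p g x) l
  × (b ≈B[ p ] lincomb l)

module Submission where

-- Write g = 1 + M with M strictly upper triangular; σ sends the class of x ∈ U¹ to the class of
-- the y with y g = g x.  For a row vector u supported on {2, 3} and a column vector v supported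
-- on {n-3, n-2}, the lift X = 1 + e₀ (u g) + v eₙᵀ is sent to Y = 1 + e₀ u + (g v) eₙᵀ, and every
-- h = g - D in U¹ fixing e₀ and eₙᵀ conjugates X to Y as soon as e₀ (u D) = (D v) eₙᵀ.
-- Applying the σ-invariance of b = c₁ ē₀₂ + c₂ ē₀₃ + c₃ ēₙ₋₃,ₙ + c₄ ēₙ₋₂,ₙ to such a lift of b
-- gives c₁ g₂₃ = 0 and c₄ gₙ₋₃,ₙ₋₂ = 0 when n ≥ 4, and c₁ g₂₃ = c₄ g₀₁ when n = 3, which is
-- exactly what makes D = (superdiagonal of g) work for the lift of b itself.  For n ≥ 4 the row
-- part c₁ ē₀₂ + c₂ ē₀₃ is a combination of two lifts (D corrected at (2, 4)) if g₂₃ = 0;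
-- otherwise c₁ = 0 and ē₀₃ is g₂₃⁻¹ times the difference of the images of 1 + M², which commutes
-- with g, and of 1 + M² - e₀ (m g), m the second row of M, which 1 + E₀₂ conjugates to its
-- σ-image.  The column part is symmetric.

open import Defs
open import Data.Nat using (ℕ; _≤_)
open import Data.Nat.Primality using (Prime; prime⇒irreducible)

import Data.Nat as ℕ
import Data.Nat.Properties as ℕ
open import Data.Integer as ℤ using (ℤ; +_; _+_; _*_; -_; _-_)
import Data.Integer.Properties as ℤ
open import Data.Integer.Tactic.RingSolver using (solve-∀)
open import Data.Fin using (Fin; zero; suc; toℕ; fromℕ; fromℕ<)
import Data.Fin.Properties as Fin
open import Data.Vec.Functional using (Vector)
open import Data.Product using (Σ; _×_; _,_; proj₁; proj₂)
open import Data.List using (List; []; _∷_; _++_; map)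
open import Data.List.Relation.Unary.All using (All; []; _∷_)
import Data.List.Relation.Unary.All.Properties as All
open import Function using (_∘_)
open import Data.Empty using (⊥-elim)
open import Relation.Binary.PropositionalEquality
open import Relation.Nullary using (¬_; Dec; yes; no)
open import Relation.Binary.Bundles using (Setoid)
import Relation.Binary.Reasoning.Setoid as SetoidReasoning
import Data.Integer.Divisibility.Signed as ℤ∣
open import Data.Nat.Coprimality using (Coprime; coprime-Bézout)
open import Data.Nat.GCD using (module Bézout)
open import Data.Nat.Divisibility using () renaming (_∣_ to _∣ₙ_)
open import Data.Sum using (inj₁; inj₂)
open import Algebra.Properties.Semiring.Sum ℤ.+-*-semiring
  using (sum; sum-cong-≗; ∑-distrib-+; ∑-comm; *-distribˡ-sum)

sumFin≡sum : ∀ {m} (f : Fin m → ℤ) → sumFin f ≡ sum f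
sumFin≡sum {ℕ.zero}  f = refl
sumFin≡sum {ℕ.suc m} f = cong (_+_ (f zero)) (sumFin≡sum (f ∘ suc))

sumFin-cong : ∀ {m} {f h : Fin m → ℤ} → (∀ k → f k ≡ h k) → sumFin f ≡ sumFin h
sumFin-cong {f = f} {h} f≗h = trans (sumFin≡sum f) (trans (sum-cong-≗ f≗h) (sym (sumFin≡sum h)))

sumFin-zero : ∀ m → sumFin {m} (λ _ → + 0) ≡ + 0
sumFin-zero ℕ.zero    = refl
sumFin-zero (ℕ.suc m) = trans (ℤ.+-identityˡ _) (sumFin-zero m)

sumFin-zeros : ∀ {m} {f : Fin m → ℤ} → (∀ k → f k ≡ + 0) → sumFin f ≡ + 0
sumFin-zeros {m} f≡0 = trans (sumFin-cong f≡0) (sumFin-zero m)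

sumFin-distrib-+ : ∀ {m} (f h : Fin m → ℤ) → sumFin (λ k → f k + h k) ≡ sumFin f + sumFin h
sumFin-distrib-+ f h = begin
  sumFin (λ k → f k + h k) ≡⟨ sumFin≡sum (λ k → f k + h k) ⟩
  sum (λ k → f k + h k)    ≡⟨ ∑-distrib-+ f h ⟩
  sum f + sum h            ≡⟨ cong₂ _+_ (sumFin≡sum f) (sumFin≡sum h) ⟨
  sumFin f + sumFin h      ∎
  where open ≡-Reasoning

sumFin-distribˡ-* : ∀ {m} c (f : Fin m → ℤ) → sumFin (λ k → c * f k) ≡ c * sumFin f
sumFin-distribˡ-* c f = begin
  sumFin (λ k → c * f k) ≡⟨ sumFin≡sum (λ k → c * f k) ⟩
  sum (λ k → c * f k)    ≡⟨ *-distribˡ-sum c f ⟨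
  c * sum f              ≡⟨ cong (c *_) (sumFin≡sum f) ⟨
  c * sumFin f           ∎
  where open ≡-Reasoning

sumFin-distribʳ-* : ∀ {m} c (f : Fin m → ℤ) → sumFin (λ k → f k * c) ≡ sumFin f * c
sumFin-distribʳ-* c f = begin
  sumFin (λ k → f k * c) ≡⟨ sumFin-cong (λ k → ℤ.*-comm (f k) c) ⟩
  sumFin (λ k → c * f k) ≡⟨ sumFin-distribˡ-* c f ⟩
  c * sumFin f           ≡⟨ ℤ.*-comm c (sumFin f) ⟩
  sumFin f * c           ∎
  where open ≡-Reasoning

sumFin-neg : ∀ {m} (f : Fin m → ℤ) → sumFin (λ k → - f k) ≡ - sumFin f
sumFin-neg f = begin
  sumFin (λ k → - f k)       ≡⟨ sumFin-cong (λ k → neg≡-1* (f k)) ⟩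
  sumFin (λ k → - + 1 * f k) ≡⟨ sumFin-distribˡ-* (- + 1) f ⟩
  - + 1 * sumFin f           ≡⟨ neg≡-1* (sumFin f) ⟨
  - sumFin f                 ∎
  where
  open ≡-Reasoning
  neg≡-1* : ∀ x → - x ≡ - + 1 * x
  neg≡-1* = solve-∀

sumFin-comm : ∀ {m m′} (f : Fin m → Fin m′ → ℤ) →
  sumFin (λ k → sumFin (f k)) ≡ sumFin (λ l → sumFin (λ k → f k l))
sumFin-comm f = begin
  sumFin (λ k → sumFin (f k))         ≡⟨ sumFin≡sum (λ k → sumFin (f k)) ⟩
  sum (λ k → sumFin (f k))            ≡⟨ sum-cong-≗ (λ k → sumFin≡sum (f k)) ⟩
  sum (λ k → sum (f k))               ≡⟨ ∑-comm f ⟩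
  sum (λ l → sum (λ k → f k l))       ≡⟨ sum-cong-≗ (λ l → sumFin≡sum (λ k → f k l)) ⟨
  sum (λ l → sumFin (λ k → f k l))    ≡⟨ sumFin≡sum (λ l → sumFin (λ k → f k l)) ⟨
  sumFin (λ l → sumFin (λ k → f k l)) ∎
  where open ≡-Reasoning

δ : ∀ {m} → Fin m → Fin m → ℤ
δ zero    zero    = + 1
δ zero    (suc _) = + 0
δ (suc _) zero    = + 0
δ (suc a) (suc b) = δ a b

δ-refl : ∀ {m} (a : Fin m) → δ a a ≡ + 1
δ-refl zero    = refl
δ-refl (suc a) = δ-refl a

δ-≢ : ∀ {m} {a b : Fin m} → a ≢ b → δ a b ≡ + 0
δ-≢ {a = zero}  {zero}  a≢b = ⊥-elim (a≢b refl)
δ-≢ {a = zero}  {suc b} a≢b = refl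
δ-≢ {a = suc a} {zero}  a≢b = refl
δ-≢ {a = suc a} {suc b} a≢b = δ-≢ (a≢b ∘ cong suc)

δ-toℕ≢ : ∀ {m} {a b : Fin m} → toℕ a ≢ toℕ b → δ a b ≡ + 0
δ-toℕ≢ a≢b = δ-≢ (a≢b ∘ cong toℕ)

δ-below : ∀ {m} {a b : Fin m} → toℕ a ℕ.< toℕ b → δ b a ≡ + 0
δ-below a<b = δ-toℕ≢ (ℕ.>⇒≢ a<b)

δ-above : ∀ {m} {a b : Fin m} → toℕ a ℕ.< toℕ b → δ a b ≡ + 0
δ-above a<b = δ-toℕ≢ (ℕ.<⇒≢ a<b)

δ-comm : ∀ {m} (a b : Fin m) → δ a b ≡ δ b a
δ-comm zero    zero    = refl
δ-comm zero    (suc b) = refl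
δ-comm (suc a) zero    = refl
δ-comm (suc a) (suc b) = δ-comm a b

sumFin-δ : ∀ {m} (a : Fin m) (f : Fin m → ℤ) → sumFin (λ k → δ a k * f k) ≡ f a
sumFin-δ {ℕ.suc m} zero f = begin
  + 1 * f zero + sumFin (λ k → + 0 * f (suc k))
    ≡⟨ cong₂ _+_ (ℤ.*-identityˡ (f zero)) (sumFin-cong (λ k → ℤ.*-zeroˡ (f (suc k)))) ⟩
  f zero + sumFin {m} (λ _ → + 0)               ≡⟨ cong (_+_ (f zero)) (sumFin-zero m) ⟩
  f zero + + 0                                  ≡⟨ ℤ.+-identityʳ _ ⟩
  f zero                                        ∎
  where open ≡-Reasoning
sumFin-δ (suc a) f = trans (cong (λ x → x + sumFin (λ k → δ a k * f (suc k))) (ℤ.*-zeroˡ (f zero)))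
                           (trans (ℤ.+-identityˡ _) (sumFin-δ a (f ∘ suc)))

cong₃ : ∀ {A B C D : Set} (f : A → B → C → D) {x x′ y y′ z z′} →
        x ≡ x′ → y ≡ y′ → z ≡ z′ → f x y z ≡ f x′ y′ z′
cong₃ f refl refl refl = refl

infix 4 _≐_
_≐_ : ∀ {n} → Mat n → Mat n → Set
A ≐ B = ∀ i j → A i j ≡ B i j

Id : ∀ {n} → Mat n
Id = δ

infix 8 _⊙_
_⊙_ : ∀ {n} → Vector ℤ (ℕ.suc n) → Vector ℤ (ℕ.suc n) → Mat n
(c ⊙ r) i j = c i * r j

infixl 7 _ᵥ⊗_ _⊗ᵥ_
_ᵥ⊗_ : ∀ {n} → Vector ℤ (ℕ.suc n) → Mat n → Vector ℤ (ℕ.suc n)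
(r ᵥ⊗ A) j = sumFin (λ k → r k * A k j)

_⊗ᵥ_ : ∀ {n} → Mat n → Vector ℤ (ℕ.suc n) → Vector ℤ (ℕ.suc n)
(A ⊗ᵥ c) i = sumFin (λ k → A i k * c k)

comb₂ : ∀ {m} → ℤ → Fin m → ℤ → Fin m → Vector ℤ m
comb₂ w a w′ b k = w * δ a k + w′ * δ b k

0ᵥ : ∀ {m} → Vector ℤ m
0ᵥ _ = + 0

⊗-distribʳ-+B : ∀ {n} (A B C : Mat n) → (A +B B) ⊗ C ≐ (A ⊗ C) +B (B ⊗ C)
⊗-distribʳ-+B A B C i j =
  trans (sumFin-cong (λ k → ℤ.*-distribʳ-+ (C k j) (A i k) (B i k)))
        (sumFin-distrib-+ (λ k → A i k * C k j) (λ k → B i k * C k j))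

⊗-distribˡ-+B : ∀ {n} (A B C : Mat n) → A ⊗ (B +B C) ≐ (A ⊗ B) +B (A ⊗ C)
⊗-distribˡ-+B A B C i j =
  trans (sumFin-cong (λ k → ℤ.*-distribˡ-+ (A i k) (B k j) (C k j)))
        (sumFin-distrib-+ (λ k → A i k * B k j) (λ k → A i k * C k j))

⊗-identityˡ : ∀ {n} (A : Mat n) → Id ⊗ A ≐ A
⊗-identityˡ A i j = sumFin-δ i (λ k → A k j)

⊗-identityʳ : ∀ {n} (A : Mat n) → A ⊗ Id ≐ A
⊗-identityʳ A i j = trans (sumFin-cong (λ k → trans (ℤ.*-comm (A i k) (δ k j)) (cong (_* A i k) (δ-comm k j))))
                          (sumFin-δ j (A i))

⊙-⊗ : ∀ {n} (c r : Vector ℤ (ℕ.suc n)) (A : Mat n) → (c ⊙ r) ⊗ A ≐ c ⊙ (r ᵥ⊗ A)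
⊙-⊗ c r A i j = trans (sumFin-cong (λ k → ℤ.*-assoc (c i) (r k) (A k j)))
                      (sumFin-distribˡ-* (c i) (λ k → r k * A k j))

⊗-⊙ : ∀ {n} (A : Mat n) (c r : Vector ℤ (ℕ.suc n)) → A ⊗ (c ⊙ r) ≐ (A ⊗ᵥ c) ⊙ r
⊗-⊙ A c r i j = trans (sumFin-cong (λ k → sym (ℤ.*-assoc (A i k) (c k) (r j))))
                      (sumFin-distribʳ-* (r j) (λ k → A i k * c k))

⊗-assoc : ∀ {n} (A B C : Mat n) → (A ⊗ B) ⊗ C ≐ A ⊗ (B ⊗ C)
⊗-assoc A B C i j = begin
  sumFin (λ k → sumFin (λ l → A i l * B l k) * C k j)
    ≡⟨ sumFin-cong (λ k → sym (sumFin-distribʳ-* (C k j) (λ l → A i l * B l k))) ⟩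
  sumFin (λ k → sumFin (λ l → A i l * B l k * C k j))
    ≡⟨ sumFin-comm (λ k l → A i l * B l k * C k j) ⟩
  sumFin (λ l → sumFin (λ k → A i l * B l k * C k j))
    ≡⟨ sumFin-cong (λ l → sumFin-cong (λ k → ℤ.*-assoc (A i l) (B l k) (C k j))) ⟩
  sumFin (λ l → sumFin (λ k → A i l * (B l k * C k j)))
    ≡⟨ sumFin-cong (λ l → sumFin-distribˡ-* (A i l) (λ k → B l k * C k j)) ⟩
  sumFin (λ l → A i l * sumFin (λ k → B l k * C k j)) ∎
  where open ≡-Reasoning

δ-ᵥ⊗ : ∀ {n} (a : Fin (ℕ.suc n)) (A : Mat n) j → (δ a ᵥ⊗ A) j ≡ A a j
δ-ᵥ⊗ a A j = sumFin-δ a (λ k → A k j)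

⊗ᵥ-δ : ∀ {n} (A : Mat n) (a : Fin (ℕ.suc n)) i → (A ⊗ᵥ δ a) i ≡ A i a
⊗ᵥ-δ A a i = trans (sumFin-cong (λ k → ℤ.*-comm (A i k) (δ a k))) (sumFin-δ a (A i))

comb₂-ᵥ⊗ : ∀ {n} w a w′ b (A : Mat n) j → (comb₂ w a w′ b ᵥ⊗ A) j ≡ w * A a j + w′ * A b j
comb₂-ᵥ⊗ w a w′ b A j = begin
  sumFin (λ k → (w * δ a k + w′ * δ b k) * A k j)
    ≡⟨ sumFin-cong (λ k → distrib w (δ a k) w′ (δ b k) (A k j)) ⟩
  sumFin (λ k → w * (δ a k * A k j) + w′ * (δ b k * A k j))
    ≡⟨ sumFin-distrib-+ (λ k → w * (δ a k * A k j)) (λ k → w′ * (δ b k * A k j)) ⟩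
  sumFin (λ k → w * (δ a k * A k j)) + sumFin (λ k → w′ * (δ b k * A k j))
    ≡⟨ cong₂ _+_ (sumFin-distribˡ-* w (λ k → δ a k * A k j)) (sumFin-distribˡ-* w′ (λ k → δ b k * A k j)) ⟩
  w * sumFin (λ k → δ a k * A k j) + w′ * sumFin (λ k → δ b k * A k j)
    ≡⟨ cong₂ (λ x y → w * x + w′ * y) (δ-ᵥ⊗ a A j) (δ-ᵥ⊗ b A j) ⟩
  w * A a j + w′ * A b j ∎
  where
  open ≡-Reasoning
  distrib : ∀ w x w′ y z → (w * x + w′ * y) * z ≡ w * (x * z) + w′ * (y * z)
  distrib = solve-∀

⊗ᵥ-comb₂ : ∀ {n} (A : Mat n) w a w′ b i → (A ⊗ᵥ comb₂ w a w′ b) i ≡ w * A i a + w′ * A i b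
⊗ᵥ-comb₂ A w a w′ b i = begin
  sumFin (λ k → A i k * (w * δ a k + w′ * δ b k))
    ≡⟨ sumFin-cong (λ k → distrib (A i k) w (δ a k) w′ (δ b k)) ⟩
  sumFin (λ k → w * (δ a k * A i k) + w′ * (δ b k * A i k))
    ≡⟨ sumFin-distrib-+ (λ k → w * (δ a k * A i k)) (λ k → w′ * (δ b k * A i k)) ⟩
  sumFin (λ k → w * (δ a k * A i k)) + sumFin (λ k → w′ * (δ b k * A i k))
    ≡⟨ cong₂ _+_ (sumFin-distribˡ-* w (λ k → δ a k * A i k)) (sumFin-distribˡ-* w′ (λ k → δ b k * A i k)) ⟩
  w * sumFin (λ k → δ a k * A i k) + w′ * sumFin (λ k → δ b k * A i k)
    ≡⟨ cong₂ (λ x y → w * x + w′ * y) (sumFin-δ a (A i)) (sumFin-δ b (A i)) ⟩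
  w * A i a + w′ * A i b ∎
  where
  open ≡-Reasoning
  distrib : ∀ x w y w′ z → x * (w * y + w′ * z) ≡ w * (y * x) + w′ * (z * x)
  distrib = solve-∀

0ᵥ-ᵥ⊗ : ∀ {n} (A : Mat n) j → (0ᵥ ᵥ⊗ A) j ≡ + 0
0ᵥ-ᵥ⊗ {n} A j = trans (sumFin-cong (λ k → ℤ.*-zeroˡ (A k j))) (sumFin-zero (ℕ.suc n))

+⊙-⊗ : ∀ {n} (C : Mat n) c r (A : Mat n) i j → ((C +B c ⊙ r) ⊗ A) i j ≡ (C ⊗ A) i j + c i * (r ᵥ⊗ A) j
+⊙-⊗ C c r A i j = trans (⊗-distribʳ-+B C (c ⊙ r) A i j) (cong (_+_ ((C ⊗ A) i j)) (⊙-⊗ c r A i j))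

⊗-+⊙ : ∀ {n} (A C : Mat n) c r i j → (A ⊗ (C +B c ⊙ r)) i j ≡ (A ⊗ C) i j + (A ⊗ᵥ c) i * r j
⊗-+⊙ A C c r i j = trans (⊗-distribˡ-+B A C (c ⊙ r) i j) (cong (_+_ ((A ⊗ C) i j)) (⊗-⊙ A c r i j))

Id+-⊗-Id+ : ∀ {n} (A B : Mat n) i j → ((Id +B A) ⊗ (Id +B B)) i j ≡ δ i j + B i j + (A i j + (A ⊗ B) i j)
Id+-⊗-Id+ A B i j = begin
  ((Id +B A) ⊗ (Id +B B)) i j
    ≡⟨ ⊗-distribʳ-+B Id A (Id +B B) i j ⟩
  (Id ⊗ (Id +B B)) i j + (A ⊗ (Id +B B)) i j
    ≡⟨ cong₂ _+_ (⊗-identityˡ (Id +B B) i j) (⊗-distribˡ-+B A Id B i j) ⟩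
  δ i j + B i j + ((A ⊗ Id) i j + (A ⊗ B) i j)
    ≡⟨ cong (λ x → δ i j + B i j + (x + (A ⊗ B) i j)) (⊗-identityʳ A i j) ⟩
  δ i j + B i j + (A i j + (A ⊗ B) i j) ∎
  where open ≡-Reasoning

ᵥ⊗-cong : ∀ {n} r {A B : Mat n} → A ≐ B → ∀ j → (r ᵥ⊗ A) j ≡ (r ᵥ⊗ B) j
ᵥ⊗-cong r A≐B j = sumFin-cong (λ k → cong (r k *_) (A≐B k j))

⊗ᵥ-cong : ∀ {n} {A B : Mat n} c → A ≐ B → ∀ i → (A ⊗ᵥ c) i ≡ (B ⊗ᵥ c) i
⊗ᵥ-cong c A≐B i = sumFin-cong (λ k → cong (_* c k) (A≐B i k))

ᵥ⊗-distrib-+B : ∀ {n} r (A B : Mat n) j → (r ᵥ⊗ (A +B B)) j ≡ (r ᵥ⊗ A) j + (r ᵥ⊗ B) j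
ᵥ⊗-distrib-+B r A B j = trans (sumFin-cong (λ k → ℤ.*-distribˡ-+ (r k) (A k j) (B k j)))
                               (sumFin-distrib-+ (λ k → r k * A k j) (λ k → r k * B k j))

⊗ᵥ-distrib-+B : ∀ {n} (A B : Mat n) c i → ((A +B B) ⊗ᵥ c) i ≡ (A ⊗ᵥ c) i + (B ⊗ᵥ c) i
⊗ᵥ-distrib-+B A B c i = trans (sumFin-cong (λ k → ℤ.*-distribʳ-+ (c k) (A i k) (B i k)))
                               (sumFin-distrib-+ (λ k → A i k * c k) (λ k → B i k * c k))

⊗ᵥ-0ᵥ : ∀ {n} (A : Mat n) i → (A ⊗ᵥ 0ᵥ) i ≡ + 0
⊗ᵥ-0ᵥ {n} A i = trans (sumFin-cong (λ k → ℤ.*-zeroʳ (A i k))) (sumFin-zero (ℕ.suc n))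

negRow-ᵥ⊗ : ∀ {n} (A : Mat n) a (B : Mat n) j → ((λ k → - A a k) ᵥ⊗ B) j ≡ - (A ⊗ B) a j
negRow-ᵥ⊗ A a B j = trans (sumFin-cong (λ k → sym (ℤ.neg-distribˡ-* (A a k) (B k j))))
                          (sumFin-neg (λ k → A a k * B k j))

⊗ᵥ-negColumn : ∀ {n} (B A : Mat n) b i → (B ⊗ᵥ (λ k → - A k b)) i ≡ - (B ⊗ A) i b
⊗ᵥ-negColumn B A b i = trans (sumFin-cong (λ k → sym (ℤ.neg-distribʳ-* (B i k) (A k b))))
                             (sumFin-neg (λ k → B i k * A k b))

-- Congruence modulo p

module Modular (p : ℕ) where

  infix 4 _≈_
  record _≈_ (a b : ℤ) : Set where
    constructor mod
    field divides : + p ℤ∣.∣ a - b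

  private
    sub-self : ∀ a → a - a ≡ + 0
    sub-self = solve-∀
    sub-swap : ∀ a b → b - a ≡ - (a - b)
    sub-swap = solve-∀
    sub-trans : ∀ a b c → a - c ≡ (a - b) + (b - c)
    sub-trans = solve-∀
    sub-+ : ∀ a b c d → (a + c) - (b + d) ≡ (a - b) + (c - d)
    sub-+ = solve-∀
    sub-* : ∀ a b c d → a * c - b * d ≡ (a - b) * c + b * (c - d)
    sub-* = solve-∀
    sub-neg : ∀ a b → - a - - b ≡ - (a - b)
    sub-neg = solve-∀

    ∣-≡ : ∀ {x y} → x ≡ y → + p ℤ∣.∣ y → + p ℤ∣.∣ x
    ∣-≡ refl d = d

  ≡⇒≈ : ∀ {a b} → a ≡ b → a ≈ b
  ≡⇒≈ {a} refl = mod (∣-≡ (sub-self a) (ℤ∣.divides (+ 0) refl))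

  ≈-refl : ∀ {a} → a ≈ a
  ≈-refl = ≡⇒≈ refl

  ≈-sym : ∀ {a b} → a ≈ b → b ≈ a
  ≈-sym {a} {b} (mod d) = mod (∣-≡ (sub-swap a b) (ℤ∣.∣m⇒∣-m d))

  ≈-trans : ∀ {a b c} → a ≈ b → b ≈ c → a ≈ c
  ≈-trans {a} {b} {c} (mod d) (mod e) = mod (∣-≡ (sub-trans a b c) (ℤ∣.∣m∣n⇒∣m+n d e))

  +-cong : ∀ {a b c d} → a ≈ b → c ≈ d → a + c ≈ b + d
  +-cong {a} {b} {c} {d} (mod x) (mod y) = mod (∣-≡ (sub-+ a b c d) (ℤ∣.∣m∣n⇒∣m+n x y))

  *-cong : ∀ {a b c d} → a ≈ b → c ≈ d → a * c ≈ b * d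
  *-cong {a} {b} {c} {d} (mod x) (mod y) =
    mod (∣-≡ (sub-* a b c d) (ℤ∣.∣m∣n⇒∣m+n (ℤ∣.∣m⇒∣m*n c x) (ℤ∣.∣n⇒∣m*n b y)))

  -‿cong : ∀ {a b} → a ≈ b → - a ≈ - b
  -‿cong {a} {b} (mod x) = mod (∣-≡ (sub-neg a b) (ℤ∣.∣m⇒∣-m x))

  ≈-setoid : Setoid _ _
  ≈-setoid = record
    { Carrier = ℤ ; _≈_ = _≈_
    ; isEquivalence = record { refl = ≈-refl ; sym = ≈-sym ; trans = ≈-trans } }

  module ≈-Reasoning = SetoidReasoning ≈-setoid

  fromDefs : ∀ {a b} → a ≡[ p ] b → a ≈ b
  fromDefs d = mod (ℤ∣.∣ᵤ⇒∣ d)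

  toDefs : ∀ {a b} → a ≈ b → a ≡[ p ] b
  toDefs (mod d) = ℤ∣.∣⇒∣ᵤ d

  +-cancelˡ-≈ : ∀ a {b c} → a + b ≈ a + c → b ≈ c
  +-cancelˡ-≈ a {b} {c} a+b≈a+c = begin
    b               ≡⟨ cancel a b ⟨
    - a + (a + b)   ≈⟨ +-cong (≈-refl { - a}) a+b≈a+c ⟩
    - a + (a + c)   ≡⟨ cancel a c ⟩
    c               ∎
    where
    open ≈-Reasoning
    cancel : ∀ a b → - a + (a + b) ≡ b
    cancel = solve-∀

  +-cancel-≈0 : ∀ a {b} → a + b ≈ a → b ≈ + 0
  +-cancel-≈0 a a+b≈a = +-cancelˡ-≈ a (≈-trans a+b≈a (≡⇒≈ (sym (ℤ.+-identityʳ a))))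

  -‿≈0 : ∀ {a} → - a ≈ + 0 → a ≈ + 0
  -‿≈0 {a} -a≈0 = ≈-trans (≡⇒≈ (sym (ℤ.neg-involutive a))) (-‿cong -a≈0)

  ≈-transport : ∀ {a a′ b b′} → a ≡ a′ → b ≡ b′ → a ≈ b → a′ ≈ b′
  ≈-transport refl refl a≈b = a≈b

  difference≈0 : ∀ {a b} → a - b ≈ + 0 → a ≈ b
  difference≈0 {a} {b} a-b≈0 = begin
    a             ≡⟨ restore a b ⟩
    a - b + b     ≈⟨ +-cong a-b≈0 (≈-refl {b}) ⟩
    + 0 + b       ≡⟨ ℤ.+-identityˡ b ⟩
    b             ∎
    where
    open ≈-Reasoning
    restore : ∀ a b → a ≡ a - b + b
    restore = solve-∀

  ≈-rescale : ∀ c {u a} → u * a ≈ + 1 → c ≈ c * u * a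
  ≈-rescale c {u} {a} ua≈1 = begin
    c           ≡⟨ ℤ.*-identityʳ c ⟨
    c * + 1     ≈⟨ *-cong (≈-refl {c}) (≈-sym ua≈1) ⟩
    c * (u * a) ≡⟨ ℤ.*-assoc c u a ⟨
    c * u * a   ∎
    where open ≈-Reasoning

  0≈*0 : ∀ c → + 0 ≈ c * + 0
  0≈*0 c = ≡⇒≈ (sym (ℤ.*-zeroʳ c))

  divisible⇒≈0 : ∀ {a} → + p ℤ∣.∣ a → a ≈ + 0
  divisible⇒≈0 {a} d = mod (∣-≡ (ℤ.+-identityʳ a) d)

  ≈0-cancel : ∀ {c a u} → c * a ≈ + 0 → u * a ≈ + 1 → c ≈ + 0
  ≈0-cancel {c} {a} {u} ca≈0 ua≈1 = begin
    c           ≡⟨ ℤ.*-identityʳ c ⟨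
    c * + 1     ≈⟨ *-cong (≈-refl {c}) (≈-sym ua≈1) ⟩
    c * (u * a) ≡⟨ reassoc c u a ⟩
    u * (c * a) ≈⟨ *-cong (≈-refl {u}) ca≈0 ⟩
    u * + 0     ≡⟨ ℤ.*-zeroʳ u ⟩
    + 0         ∎
    where
    open ≈-Reasoning
    reassoc : ∀ c u a → c * (u * a) ≡ u * (c * a)
    reassoc = solve-∀

  module _ (prime : Prime p) where

    private
      coprime : ∀ {m} → ¬ p ∣ₙ m → Coprime p m
      coprime p∤m (d∣p , d∣m) with prime⇒irreducible prime d∣p
      ... | inj₁ d≡1   = d≡1
      ... | inj₂ refl  = ⊥-elim (p∤m d∣m)

      inverse-ℕ : ∀ {m} → Bézout.Identity 1 p m → Σ ℤ λ u → u * + m ≈ + 1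
      inverse-ℕ {m} (Bézout.-+ x y 1+xp≡ym) = + y , mod (ℤ∣.divides (+ x) (begin
        + y * + m - + 1           ≡⟨ cong (_- + 1) (ℤ.pos-* y m) ⟨
        + (y ℕ.* m) - + 1         ≡⟨ cong (λ t → + t - + 1) 1+xp≡ym ⟨
        + (1 ℕ.+ x ℕ.* p) - + 1   ≡⟨ cong (_- + 1) (trans (ℤ.pos-+ 1 (x ℕ.* p)) (cong (_+_ (+ 1)) (ℤ.pos-* x p))) ⟩
        + 1 + + x * + p - + 1     ≡⟨ cancel (+ x * + p) ⟩
        + x * + p                 ∎))
        where
        open ≡-Reasoning
        cancel : ∀ t → + 1 + t - + 1 ≡ t
        cancel = solve-∀
      inverse-ℕ {m} (Bézout.+- x y 1+ym≡xp) = - + y , mod (ℤ∣.divides (- + x) (begin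
        - + y * + m - + 1         ≡⟨ rearrange (+ y) (+ m) ⟩
        - (+ 1 + + y * + m)       ≡⟨ cong (λ t → - t) (trans (ℤ.pos-+ 1 (y ℕ.* m)) (cong (_+_ (+ 1)) (ℤ.pos-* y m))) ⟨
        - + (1 ℕ.+ y ℕ.* m)       ≡⟨ cong (λ t → - + t) 1+ym≡xp ⟩
        - + (x ℕ.* p)             ≡⟨ cong (λ t → - t) (ℤ.pos-* x p) ⟩
        - (+ x * + p)             ≡⟨ ℤ.neg-distribˡ-* (+ x) (+ p) ⟩
        - + x * + p               ∎))
        where
        open ≡-Reasoning
        rearrange : ∀ a b → - a * b - + 1 ≡ - (+ 1 + a * b)
        rearrange = solve-∀

    inverse : ∀ {a} → ¬ (+ p ℤ∣.∣ a) → Σ ℤ λ u → u * a ≈ + 1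
    inverse {a} p∤a with inverse-ℕ (coprime-Bézout (coprime (p∤a ∘ ℤ∣.∣ᵤ⇒∣))) | ℤ.+∣i∣≡i⊎+∣i∣≡-i a
    ... | u , u∣a∣≈1 | inj₁ ∣a∣≡a  = u , subst (λ t → u * t ≈ + 1) ∣a∣≡a u∣a∣≈1
    ... | u , u∣a∣≈1 | inj₂ ∣a∣≡-a =
      - u , ≈-trans (≡⇒≈ (trans (flip-sign u a) (cong (u *_) (sym ∣a∣≡-a)))) u∣a∣≈1
      where
      flip-sign : ∀ u a → - u * a ≡ u * - a
      flip-sign = solve-∀

  sumFin-cong-≈ : ∀ {m} {f h : Fin m → ℤ} → (∀ k → f k ≈ h k) → sumFin f ≈ sumFin h
  sumFin-cong-≈ {ℕ.zero}  f≈h = ≈-refl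
  sumFin-cong-≈ {ℕ.suc m} f≈h = +-cong (f≈h zero) (sumFin-cong-≈ (f≈h ∘ suc))

  ⊗-cong-≈ : ∀ {n} {A A′ B B′ : Mat n} → (∀ i j → A i j ≈ A′ i j) → (∀ i j → B i j ≈ B′ i j) →
             ∀ i j → (A ⊗ B) i j ≈ (A′ ⊗ B′) i j
  ⊗-cong-≈ A≈A′ B≈B′ i j = sumFin-cong-≈ (λ k → *-cong (A≈A′ i k) (B≈B′ k j))

-- m = 0: A is unitriangular; m = 1: A lies in U¹.
AgreesWithId : ∀ {n} → ℕ → Mat n → Set
AgreesWithId m A = ∀ i j → toℕ j ℕ.≤ m ℕ.+ toℕ i → A i j ≡ δ i j

ZeroUpTo : ∀ {n} → ℕ → Mat n → Set
ZeroUpTo m P = ∀ i j → toℕ j ℕ.≤ m ℕ.+ toℕ i → P i j ≡ + 0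

Id-agreesWithId : ∀ {n} m → AgreesWithId {n} m Id
Id-agreesWithId m i j _ = refl

+B-agreesWithId : ∀ {n m} {A P : Mat n} → AgreesWithId m A → ZeroUpTo m P → AgreesWithId m (A +B P)
+B-agreesWithId {A = A} {P} A≈I P≡0 i j j≤ =
  trans (cong₂ _+_ (A≈I i j j≤) (P≡0 i j j≤)) (ℤ.+-identityʳ (δ i j))

e₀⊙-zeroUpTo : ∀ {n m} {r : Vector ℤ (ℕ.suc n)} → (∀ j → toℕ j ℕ.≤ m → r j ≡ + 0) →
               ZeroUpTo m (δ zero ⊙ r)
e₀⊙-zeroUpTo {m = m} r≡0 zero    j j≤ = cong (+ 1 *_) (r≡0 j (subst (toℕ j ℕ.≤_) (ℕ.+-identityʳ m) j≤))
e₀⊙-zeroUpTo               r≡0 (suc i) j j≤ = refl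

⊙eₙ-zeroUpTo : ∀ {n m} {c : Vector ℤ (ℕ.suc n)} → (∀ i → n ℕ.≤ m ℕ.+ toℕ i → c i ≡ + 0) →
               ZeroUpTo m (c ⊙ δ (fromℕ n))
⊙eₙ-zeroUpTo {n} {m} {c} c≡0 i j j≤ with j Data.Fin.≟ fromℕ n
... | yes refl =
  trans (cong (_* δ (fromℕ n) (fromℕ n)) (c≡0 i (subst (ℕ._≤ m ℕ.+ toℕ i) (Fin.toℕ-fromℕ n) j≤)))
        (ℤ.*-zeroˡ (δ (fromℕ n) (fromℕ n)))
... | no  j≢n  = trans (cong (c i *_) (δ-≢ (j≢n ∘ sym))) (ℤ.*-zeroʳ (c i))

agreesWithId-weaken : ∀ {n m} {A : Mat n} → AgreesWithId (ℕ.suc m) A → AgreesWithId m A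
agreesWithId-weaken A≈I i j j≤ = A≈I i j (ℕ.m≤n⇒m≤1+n j≤)

column-zero : ∀ {n} {A : Mat n} → AgreesWithId 0 A → ∀ i → (A ⊗ᵥ δ zero) i ≡ δ zero i
column-zero {A = A} A≈I i = trans (⊗ᵥ-δ A zero i) (trans (A≈I i zero ℕ.z≤n) (δ-comm i zero))

row-last : ∀ {n} {A : Mat n} → AgreesWithId 0 A → ∀ j → (δ (fromℕ n) ᵥ⊗ A) j ≡ δ (fromℕ n) j
row-last {n} {A} A≈I j = trans (δ-ᵥ⊗ _ A j)
  (A≈I _ j (subst (toℕ j ℕ.≤_) (sym (Fin.toℕ-fromℕ n)) (ℕ.≤-pred (Fin.toℕ<n j))))

⊗-zeroUpTo : ∀ {n} {A B : Mat n} → ZeroUpTo 0 A → ZeroUpTo 0 B → ZeroUpTo 1 (A ⊗ B)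
⊗-zeroUpTo {A = A} {B} A≡0 B≡0 i j j≤1+i = sumFin-zeros term≡0
  where
  term≡0 : ∀ k → A i k * B k j ≡ + 0
  term≡0 k with toℕ k ℕ.≤? toℕ i
  ... | yes k≤i = trans (cong (_* B k j) (A≡0 i k k≤i)) (ℤ.*-zeroˡ (B k j))
  ... | no  k≰i = trans (cong (A i k *_) (B≡0 k j (ℕ.≤-trans j≤1+i (ℕ.≰⇒> k≰i)))) (ℤ.*-zeroʳ (A i k))

module _ (p : ℕ) where
  open Modular p

  agreesWithId⇒InU : ∀ {n} {A : Mat n} → AgreesWithId 0 A → InU p A
  agreesWithId⇒InU {A = A} A≈I i j =
      (λ j<i → toDefs (≡⇒≈ (trans (A≈I i j (ℕ.<⇒≤ j<i)) (δ-below j<i))))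
    , (λ { refl → toDefs (≡⇒≈ (trans (A≈I i i ℕ.≤-refl) (δ-refl i))) })

  agreesWithId⇒InU¹ : ∀ {n} {A : Mat n} → AgreesWithId 1 A → InUm p 1 A
  agreesWithId⇒InU¹ {A = A} A≈I =
      agreesWithId⇒InU (agreesWithId-weaken A≈I)
    , λ i j i<j j∸i≤1 → toDefs (≡⇒≈ (trans (A≈I i j (j≤1+i i<j j∸i≤1)) (δ-above i<j)))
    where
    j≤1+i : ∀ {a b} → a ℕ.< b → b ℕ.∸ a ℕ.≤ 1 → b ℕ.≤ 1 ℕ.+ a
    j≤1+i {a} a<b b∸a≤1 = subst (ℕ._≤ 1 ℕ.+ a) (ℕ.m∸n+n≡m (ℕ.<⇒≤ a<b)) (ℕ.+-monoˡ-≤ a b∸a≤1)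

module BEquality (p : ℕ) {n : ℕ} where
  open Modular p

  infix 4 _≈ᴮ_
  record _≈ᴮ_ (b c : Mat n) : Set where
    constructor onBPos
    field at : ∀ i j → BPos i j → b i j ≈ c i j
  open _≈ᴮ_ public

  fromDefsᴮ : {b c : Mat n} → b ≈B[ p ] c → b ≈ᴮ c
  fromDefsᴮ b≈c = onBPos (λ i j ij → fromDefs (b≈c i j ij))

  toDefsᴮ : {b c : Mat n} → b ≈ᴮ c → b ≈B[ p ] c
  toDefsᴮ b≈c i j ij = toDefs (at b≈c i j ij)

  ≈ᴮ-setoid : Setoid _ _
  ≈ᴮ-setoid = record
    { Carrier = Mat n ; _≈_ = _≈ᴮ_
    ; isEquivalence = record
      { refl  = onBPos (λ _ _ _ → ≈-refl)
      ; sym   = λ b≈c → onBPos (λ i j ij → ≈-sym (at b≈c i j ij))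
      ; trans = λ b≈c c≈d → onBPos (λ i j ij → ≈-trans (at b≈c i j ij) (at c≈d i j ij)) } }

  module ≈ᴮ-Reasoning = SetoidReasoning ≈ᴮ-setoid

  open Setoid ≈ᴮ-setoid public using () renaming (sym to ≈ᴮ-sym; trans to ≈ᴮ-trans)

  +B-cong : {b b′ c c′ : Mat n} → b ≈ᴮ b′ → c ≈ᴮ c′ → b +B c ≈ᴮ b′ +B c′
  +B-cong b≈b′ c≈c′ = onBPos (λ i j ij → +-cong (at b≈b′ i j ij) (at c≈c′ i j ij))

  ·B-cong : ∀ {a a′} {b b′ : Mat n} → a ≈ a′ → b ≈ᴮ b′ → a ·B b ≈ᴮ a′ ·B b′
  ·B-cong a≈a′ b≈b′ = onBPos (λ i j ij → *-cong a≈a′ (at b≈b′ i j ij))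

  ≐⇒≈ᴮ : {b c : Mat n} → b ≐ c → b ≈ᴮ c
  ≐⇒≈ᴮ b≐c = onBPos (λ i j _ → ≡⇒≈ (b≐c i j))

lincomb-++ : ∀ {n} (l l′ : List (ℤ × Mat n)) → lincomb (l ++ l′) ≐ lincomb l +B lincomb l′
lincomb-++ []              l′ i j = sym (ℤ.+-identityˡ _)
lincomb-++ ((c , x) ∷ l) l′ i j =
  trans (cong (_+_ (c * x i j)) (lincomb-++ l l′ i j)) (sym (ℤ.+-assoc (c * x i j) _ _))

scaleCoefficients : ∀ {n} → ℤ → List (ℤ × Mat n) → List (ℤ × Mat n)
scaleCoefficients α = map (λ (c , x) → (α * c , x))

lincomb-scale : ∀ {n} α (l : List (ℤ × Mat n)) → lincomb (scaleCoefficients α l) ≐ α ·B lincomb l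
lincomb-scale α []            i j = sym (ℤ.*-zeroʳ α)
lincomb-scale α ((c , x) ∷ l) i j =
  trans (cong (_+_ (α * c * x i j)) (lincomb-scale α l i j)) (distrib α c (x i j) _)
  where
  distrib : ∀ α c x y → α * c * x + α * y ≡ α * (c * x + y)
  distrib = solve-∀

module Generated (p : ℕ) {n : ℕ} (g : Mat n) where
  open Modular p
  open BEquality p {n}
  open ≈ᴮ-Reasoning

  InGenFixed-respects : {b c : Mat n} → b ≈ᴮ c → InGenFixed p g c → InGenFixed p g b
  InGenFixed-respects {b} {c} b≈c (l , fixed , c≈l) = l , fixed , toDefsᴮ (begin
    b          ≈⟨ b≈c ⟩
    c          ≈⟨ fromDefsᴮ {c} {lincomb l} c≈l ⟩
    lincomb l  ∎)

  InGenFixed-generator : {x : Mat n} → InUm p 1 x → ClassFixed p g x → InGenFixed p g x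
  InGenFixed-generator {x} x∈U¹ x-fixed =
    ((+ 1 , x) ∷ []) , ((x∈U¹ , x-fixed) ∷ []) ,
    toDefsᴮ (≐⇒≈ᴮ (λ i j → sym (trans (ℤ.+-identityʳ _) (ℤ.*-identityˡ (x i j)))))

  InGenFixed-+B : {b c : Mat n} → InGenFixed p g b → InGenFixed p g c → InGenFixed p g (b +B c)
  InGenFixed-+B {b} {c} (l , fixed , b≈l) (l′ , fixed′ , c≈l′) =
    l ++ l′ , All.++⁺ fixed fixed′ , toDefsᴮ (begin
    b +B c                   ≈⟨ +B-cong {b} {lincomb l} {c} {lincomb l′} (fromDefsᴮ b≈l) (fromDefsᴮ c≈l′) ⟩
    lincomb l +B lincomb l′  ≈⟨ ≐⇒≈ᴮ (λ i j → sym (lincomb-++ l l′ i j)) ⟩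
    lincomb (l ++ l′)        ∎)

  InGenFixed-·B : ∀ α {b : Mat n} → InGenFixed p g b → InGenFixed p g (α ·B b)
  InGenFixed-·B α {b} (l , fixed , b≈l) = scaleCoefficients α l , All.map⁺ fixed , toDefsᴮ (begin
    α ·B b                          ≈⟨ ·B-cong {α} {α} {b} {lincomb l} ≈-refl (fromDefsᴮ b≈l) ⟩
    α ·B lincomb l                  ≈⟨ ≐⇒≈ᴮ (λ i j → sym (lincomb-scale α l i j)) ⟩
    lincomb (scaleCoefficients α l) ∎)

ebar-δ : ∀ {n} (A C : Fin (ℕ.suc n)) {a c : ℕ} → toℕ A ≡ a → toℕ C ≡ c →
         ∀ i j → ebar a c i j ≡ δ A i * δ C j
ebar-δ A C {a} {c} A≡a C≡c i j with toℕ i ℕ.≟ a | toℕ j ℕ.≟ c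
... | yes i≡a | yes j≡c with Fin.toℕ-injective (trans i≡a (sym A≡a)) | Fin.toℕ-injective (trans j≡c (sym C≡c))
...   | refl | refl = sym (cong₂ _*_ (δ-refl A) (δ-refl C))
ebar-δ A C A≡a C≡c i j | yes _ | no j≢c =
  sym (trans (cong (δ A i *_) (δ-toℕ≢ (λ C≡j → j≢c (trans (sym C≡j) C≡c)))) (ℤ.*-zeroʳ (δ A i)))
ebar-δ A C A≡a C≡c i j | no i≢a | _ =
  sym (trans (cong (_* δ C j) (δ-toℕ≢ (λ A≡i → i≢a (trans (sym A≡i) A≡a)))) (ℤ.*-zeroˡ (δ C j)))

BPos-δ : ∀ {n} (i j : Fin (ℕ.suc n)) → BPos i j → δ i j ≡ + 0
BPos-δ i j (2+i≤j , _) = δ-above (ℕ.≤-trans (ℕ.n≤1+n _) 2+i≤j)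

-- σ-fixed classes built from g, for n = 3 + k

module FixedClasses (p k : ℕ) (g : Mat (3 ℕ.+ k)) (gU : InU p g) where
  open Modular p
  open BEquality p {3 ℕ.+ k}
  open Generated p g

  private
    n : ℕ
    n = 3 ℕ.+ k

  -- G = 1 + M is the exact unitriangular integer representative of g.
  M : Mat n
  M i j with toℕ i ℕ.<? toℕ j
  ... | yes _ = g i j
  ... | no  _ = + 0

  G : Mat n
  G = Id +B M

  M-strict : ZeroUpTo 0 M
  M-strict i j j≤i with toℕ i ℕ.<? toℕ j
  ... | yes i<j = ⊥-elim (ℕ.<⇒≱ i<j j≤i)
  ... | no  _   = refl

  G-unitriangular : AgreesWithId 0 G
  G-unitriangular = +B-agreesWithId (Id-agreesWithId 0) M-strict

  G≈g : ∀ i j → G i j ≈ g i j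
  G≈g i j with toℕ i ℕ.<? toℕ j
  ... | yes i<j = ≡⇒≈ (trans (cong (_+ g i j) (δ-above i<j)) (ℤ.+-identityˡ (g i j)))
  ... | no  i≮j with toℕ j ℕ.<? toℕ i
  ...   | yes j<i = ≈-sym (≈-trans (fromDefs (proj₁ (gU i j) j<i))
                             (≡⇒≈ (sym (trans (ℤ.+-identityʳ (δ i j)) (δ-below j<i)))))
  ...   | no  j≮i with Fin.toℕ-injective (ℕ.≤-antisym (ℕ.≮⇒≥ j≮i) (ℕ.≮⇒≥ i≮j))
  ...     | refl = ≈-sym (≈-trans (fromDefs (proj₂ (gU i i) refl))
                                  (≡⇒≈ (sym (trans (ℤ.+-identityʳ (δ i i)) (δ-refl i)))))

  i₂ i₃ iₙ n₃ n₂ : Fin (ℕ.suc n)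
  i₂ = suc (suc zero)
  i₃ = suc (suc (suc zero))
  iₙ = fromℕ n
  n₃ = fromℕ< (ℕ.m<n+m k {4} ℕ.z<s)
  n₂ = fromℕ< (ℕ.m<n+m (ℕ.suc k) {3} ℕ.z<s)

  a₂ aₙ : ℤ
  a₂ = M i₂ i₃
  aₙ = M n₃ n₂

  X Y : Mat n → Vector ℤ (ℕ.suc n) → Vector ℤ (ℕ.suc n) → Mat n
  X C u v = C +B δ zero ⊙ (u ᵥ⊗ G) +B v ⊙ δ iₙ
  Y C u v = C +B δ zero ⊙ u +B (G ⊗ᵥ v) ⊙ δ iₙ

  ⊗-X : ∀ A C u v i j → (A ⊗ X C u v) i j ≡ (A ⊗ C) i j + (A ⊗ᵥ δ zero) i * (u ᵥ⊗ G) j + (A ⊗ᵥ v) i * δ iₙ j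
  ⊗-X A C u v i j = trans (⊗-+⊙ A (C +B δ zero ⊙ (u ᵥ⊗ G)) v (δ iₙ) i j)
                          (cong (_+ (A ⊗ᵥ v) i * δ iₙ j) (⊗-+⊙ A C (δ zero) (u ᵥ⊗ G) i j))

  Y-⊗ : ∀ C u v A i j → (Y C u v ⊗ A) i j ≡ (C ⊗ A) i j + δ zero i * (u ᵥ⊗ A) j + (G ⊗ᵥ v) i * (δ iₙ ᵥ⊗ A) j
  Y-⊗ C u v A i j = trans (+⊙-⊗ (C +B δ zero ⊙ u) (G ⊗ᵥ v) (δ iₙ) A i j)
                          (cong (_+ (G ⊗ᵥ v) i * (δ iₙ ᵥ⊗ A) j) (+⊙-⊗ C (δ zero) u A i j))

  Y-intertwines : ∀ C u v → C ⊗ G ≐ G ⊗ C → Y C u v ⊗ G ≐ G ⊗ X C u v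
  Y-intertwines C u v CG≐GC i j = begin
    (Y C u v ⊗ G) i j
      ≡⟨ Y-⊗ C u v G i j ⟩
    (C ⊗ G) i j + δ zero i * (u ᵥ⊗ G) j + (G ⊗ᵥ v) i * (δ iₙ ᵥ⊗ G) j
      ≡⟨ cong₃ (λ x y z → x + y * (u ᵥ⊗ G) j + (G ⊗ᵥ v) i * z)
               (CG≐GC i j) (sym (column-zero G-unitriangular i)) (row-last G-unitriangular j) ⟩
    (G ⊗ C) i j + (G ⊗ᵥ δ zero) i * (u ᵥ⊗ G) j + (G ⊗ᵥ v) i * δ iₙ j
      ≡⟨ ⊗-X G C u v i j ⟨
    (G ⊗ X C u v) i j ∎
    where open ≡-Reasoning

  intertwines-mod : ∀ {x y} → y ⊗ G ≐ G ⊗ x → ∀ i j → (y ⊗ g) i j ≈ (g ⊗ x) i j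
  intertwines-mod {x} {y} yG≐Gx i j = begin
    (y ⊗ g) i j ≈⟨ ⊗-cong-≈ {A = y} {y} {g} {G} (λ _ _ → ≈-refl) (λ a b → ≈-sym (G≈g a b)) i j ⟩
    (y ⊗ G) i j ≡⟨ yG≐Gx i j ⟩
    (G ⊗ x) i j ≈⟨ ⊗-cong-≈ {A = G} {g} {x} {x} G≈g (λ _ _ → ≈-refl) i j ⟩
    (g ⊗ x) i j ∎
    where open ≈-Reasoning

  conjugation⇒InGenFixed : ∀ {x y h} → AgreesWithId 1 x → AgreesWithId 0 y → AgreesWithId 1 h →
    y ⊗ G ≐ G ⊗ x → (∀ i j → (h ⊗ x) i j ≈ (y ⊗ h) i j) → InGenFixed p g x
  conjugation⇒InGenFixed {x} {y} {h} x∈U¹ y∈U h∈U¹ yG≐Gx hx≈yh =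
    InGenFixed-generator {x} (agreesWithId⇒InU¹ p x∈U¹)
      (y , agreesWithId⇒InU p y∈U , (λ i j → toDefs (intertwines-mod {x} {y} yG≐Gx i j)) ,
       h , agreesWithId⇒InU¹ p h∈U¹ , (λ i j → toDefs (hx≈yh i j)))

  toℕ-iₙ : toℕ iₙ ≡ n
  toℕ-iₙ = Fin.toℕ-fromℕ n

  toℕ-n₃ : toℕ n₃ ≡ k
  toℕ-n₃ = Fin.toℕ-fromℕ< (ℕ.m<n+m k {4} ℕ.z<s)

  toℕ-n₂ : toℕ n₂ ≡ ℕ.suc k
  toℕ-n₂ = Fin.toℕ-fromℕ< (ℕ.m<n+m (ℕ.suc k) {3} ℕ.z<s)

  n₃<n₂ : toℕ n₃ ℕ.< toℕ n₂
  n₃<n₂ = subst₂ ℕ._<_ (sym toℕ-n₃) (sym toℕ-n₂) (ℕ.n<1+n k)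

  n₂<iₙ : toℕ n₂ ℕ.< toℕ iₙ
  n₂<iₙ = subst₂ ℕ._<_ (sym toℕ-n₂) (sym toℕ-iₙ) (ℕ.s≤s (ℕ.n≤1+n (ℕ.suc k)))

  M-row₂ : ∀ j → toℕ j ℕ.≤ 3 → M i₂ j ≡ a₂ * δ i₃ j
  M-row₂ j j≤3 with toℕ j ℕ.≟ 3
  ... | yes j≡3 with Fin.toℕ-injective {i = j} {j = i₃} j≡3
  ...   | refl = sym (ℤ.*-identityʳ a₂)
  M-row₂ j j≤3 | no j≢3 = trans (M-strict i₂ j (ℕ.≤-pred (ℕ.≤∧≢⇒< j≤3 j≢3)))
                                (sym (trans (cong (a₂ *_) (δ-toℕ≢ (j≢3 ∘ sym))) (ℤ.*-zeroʳ a₂)))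

  M-row₃ : ∀ j → toℕ j ℕ.≤ 3 → M i₃ j ≡ + 0
  M-row₃ = M-strict i₃

  M-col₂ : ∀ i → n ℕ.≤ 3 ℕ.+ toℕ i → M i n₂ ≡ aₙ * δ n₃ i
  M-col₂ i n≤3+i with toℕ i ℕ.≟ k
  ... | yes i≡k with Fin.toℕ-injective {i = i} {j = n₃} (trans i≡k (sym toℕ-n₃))
  ...   | refl = sym (trans (cong (aₙ *_) (δ-refl n₃)) (ℤ.*-identityʳ aₙ))
  M-col₂ i n≤3+i | no i≢k =
    trans (M-strict i n₂ (subst (ℕ._≤ toℕ i) (sym toℕ-n₂) (ℕ.≤∧≢⇒< (ℕ.+-cancelˡ-≤ 3 k (toℕ i) n≤3+i) (i≢k ∘ sym))))
          (sym (trans (cong (aₙ *_) (δ-toℕ≢ (λ n₃≡i → i≢k (trans (sym n₃≡i) toℕ-n₃)))) (ℤ.*-zeroʳ aₙ)))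

  M-col₃ : ∀ i → n ℕ.≤ 3 ℕ.+ toℕ i → M i n₃ ≡ + 0
  M-col₃ i n≤3+i = M-strict i n₃ (subst (ℕ._≤ toℕ i) (sym toℕ-n₃) (ℕ.+-cancelˡ-≤ 3 k (toℕ i) n≤3+i))

  uG-low : ∀ w w′ j → toℕ j ℕ.≤ 3 → (comb₂ w i₂ w′ i₃ ᵥ⊗ G) j ≡ w * δ i₂ j + (w * a₂ + w′) * δ i₃ j
  uG-low w w′ j j≤3 = begin
    (comb₂ w i₂ w′ i₃ ᵥ⊗ G) j
      ≡⟨ comb₂-ᵥ⊗ w i₂ w′ i₃ G j ⟩
    w * (δ i₂ j + M i₂ j) + w′ * (δ i₃ j + M i₃ j)
      ≡⟨ cong₂ (λ x y → w * (δ i₂ j + x) + w′ * (δ i₃ j + y)) (M-row₂ j j≤3) (M-row₃ j j≤3) ⟩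
    w * (δ i₂ j + a₂ * δ i₃ j) + w′ * (δ i₃ j + + 0)
      ≡⟨ regroup w w′ a₂ (δ i₂ j) (δ i₃ j) ⟩
    w * δ i₂ j + (w * a₂ + w′) * δ i₃ j ∎
    where
    open ≡-Reasoning
    regroup : ∀ w w′ a x y → w * (x + a * y) + w′ * (y + + 0) ≡ w * x + (w * a + w′) * y
    regroup = solve-∀

  Gv-high : ∀ z z′ i → n ℕ.≤ 3 ℕ.+ toℕ i → (G ⊗ᵥ comb₂ z n₃ z′ n₂) i ≡ (z + z′ * aₙ) * δ n₃ i + z′ * δ n₂ i
  Gv-high z z′ i n≤3+i = begin
    (G ⊗ᵥ comb₂ z n₃ z′ n₂) i
      ≡⟨ ⊗ᵥ-comb₂ G z n₃ z′ n₂ i ⟩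
    z * (δ i n₃ + M i n₃) + z′ * (δ i n₂ + M i n₂)
      ≡⟨ cong₂ (λ x y → z * (δ i n₃ + x) + z′ * (δ i n₂ + y)) (M-col₃ i n≤3+i) (M-col₂ i n≤3+i) ⟩
    z * (δ i n₃ + + 0) + z′ * (δ i n₂ + aₙ * δ n₃ i)
      ≡⟨ cong₂ (λ x y → z * (x + + 0) + z′ * (y + aₙ * δ n₃ i)) (δ-comm i n₃) (δ-comm i n₂) ⟩
    z * (δ n₃ i + + 0) + z′ * (δ n₂ i + aₙ * δ n₃ i)
      ≡⟨ regroup z z′ aₙ (δ n₃ i) (δ n₂ i) ⟩
    (z + z′ * aₙ) * δ n₃ i + z′ * δ n₂ i ∎
    where
    open ≡-Reasoning
    regroup : ∀ z z′ a x y → z * (x + + 0) + z′ * (y + a * x) ≡ (z + z′ * a) * x + z′ * y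
    regroup = solve-∀

  row-at-BPos : ∀ {r r′ : Vector ℤ (ℕ.suc n)} → (∀ j → toℕ j ℕ.≤ 3 → r j ≡ r′ j) →
                ∀ i j → BPos i j → δ zero i * r j ≡ δ zero i * r′ j
  row-at-BPos r≡r′ zero    j (_ , j≤3) = cong (+ 1 *_) (r≡r′ j j≤3)
  row-at-BPos r≡r′ (suc i) j _         = refl

  col-at-BPos : ∀ {c c′ : Vector ℤ (ℕ.suc n)} → (∀ i → n ℕ.≤ 3 ℕ.+ toℕ i → c i ≡ c′ i) →
                ∀ i j → BPos i j → c i * δ iₙ j ≡ c′ i * δ iₙ j
  col-at-BPos {c} {c′} c≡c′ i j (_ , j≤3+i) with j Data.Fin.≟ iₙ
  ... | yes refl = cong (_* δ iₙ iₙ) (c≡c′ i (subst (ℕ._≤ 3 ℕ.+ toℕ i) toℕ-iₙ j≤3+i))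
  ... | no  j≢n  rewrite δ-≢ (j≢n ∘ sym) = trans (ℤ.*-zeroʳ (c i)) (sym (ℤ.*-zeroʳ (c′ i)))

  opaque
    B₀ : ℤ → ℤ → ℤ → ℤ → Mat n
    B₀ c₁ c₂ c₃ c₄ =
      (c₁ ·B ebar 0 2) +B ((c₂ ·B ebar 0 3) +B ((c₃ ·B ebar (n ℕ.∸ 3) n) +B (c₄ ·B ebar (n ℕ.∸ 2) n)))

  opaque
   unfolding B₀

   InB0⇒B₀ : ∀ {b} → InB0 p n b → Σ ℤ λ c₁ → Σ ℤ λ c₂ → Σ ℤ λ c₃ → Σ ℤ λ c₄ → b ≈ᴮ B₀ c₁ c₂ c₃ c₄
   InB0⇒B₀ {b} (c₁ , c₂ , c₃ , c₄ , b≈) = c₁ , c₂ , c₃ , c₄ , fromDefsᴮ {b} {B₀ c₁ c₂ c₃ c₄} b≈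

   B₀-entry : ∀ c₁ c₂ c₃ c₄ i j →
     B₀ c₁ c₂ c₃ c₄ i j ≡ δ zero i * (c₁ * δ i₂ j + c₂ * δ i₃ j) + (c₃ * δ n₃ i + c₄ * δ n₂ i) * δ iₙ j
   B₀-entry c₁ c₂ c₃ c₄ i j = begin
     c₁ * ebar 0 2 i j + (c₂ * ebar 0 3 i j + (c₃ * ebar k n i j + c₄ * ebar (ℕ.suc k) n i j))
       ≡⟨ cong₂ (λ x y → c₁ * x + (c₂ * y + (c₃ * ebar k n i j + c₄ * ebar (ℕ.suc k) n i j)))
                (ebar-δ zero i₂ refl refl i j) (ebar-δ zero i₃ refl refl i j) ⟩
     c₁ * (δ zero i * δ i₂ j) + (c₂ * (δ zero i * δ i₃ j) + (c₃ * ebar k n i j + c₄ * ebar (ℕ.suc k) n i j))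
       ≡⟨ cong₂ (λ x y → c₁ * (δ zero i * δ i₂ j) + (c₂ * (δ zero i * δ i₃ j) + (c₃ * x + c₄ * y)))
                (ebar-δ n₃ iₙ toℕ-n₃ toℕ-iₙ i j) (ebar-δ n₂ iₙ toℕ-n₂ toℕ-iₙ i j) ⟩
     c₁ * (δ zero i * δ i₂ j) + (c₂ * (δ zero i * δ i₃ j) + (c₃ * (δ n₃ i * δ iₙ j) + c₄ * (δ n₂ i * δ iₙ j)))
       ≡⟨ regroup c₁ c₂ c₃ c₄ (δ zero i) (δ i₂ j) (δ i₃ j) (δ n₃ i) (δ n₂ i) (δ iₙ j) ⟩
     δ zero i * (c₁ * δ i₂ j + c₂ * δ i₃ j) + (c₃ * δ n₃ i + c₄ * δ n₂ i) * δ iₙ j ∎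
     where
     open ≡-Reasoning
     regroup : ∀ c₁ c₂ c₃ c₄ e x₂ x₃ y₃ y₂ f →
       c₁ * (e * x₂) + (c₂ * (e * x₃) + (c₃ * (y₃ * f) + c₄ * (y₂ * f))) ≡ e * (c₁ * x₂ + c₂ * x₃) + (c₃ * y₃ + c₄ * y₂) * f
     regroup = solve-∀

   B₀-+B : ∀ x y z w x′ y′ z′ w′ → B₀ x y z w +B B₀ x′ y′ z′ w′ ≐ B₀ (x + x′) (y + y′) (z + z′) (w + w′)
   B₀-+B x y z w x′ y′ z′ w′ i j =
     distrib x y z w x′ y′ z′ w′ (ebar 0 2 i j) (ebar 0 3 i j) (ebar k n i j) (ebar (ℕ.suc k) n i j)
     where
     distrib : ∀ x y z w x′ y′ z′ w′ e₁ e₂ e₃ e₄ →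
       x * e₁ + (y * e₂ + (z * e₃ + w * e₄)) + (x′ * e₁ + (y′ * e₂ + (z′ * e₃ + w′ * e₄)))
         ≡ (x + x′) * e₁ + ((y + y′) * e₂ + ((z + z′) * e₃ + (w + w′) * e₄))
     distrib = solve-∀

   B₀-·B : ∀ α x y z w → α ·B B₀ x y z w ≐ B₀ (α * x) (α * y) (α * z) (α * w)
   B₀-·B α x y z w i j = distrib α x y z w (ebar 0 2 i j) (ebar 0 3 i j) (ebar k n i j) (ebar (ℕ.suc k) n i j)
     where
     distrib : ∀ α x y z w e₁ e₂ e₃ e₄ →
       α * (x * e₁ + (y * e₂ + (z * e₃ + w * e₄))) ≡ α * x * e₁ + (α * y * e₂ + (α * z * e₃ + α * w * e₄))
     distrib = solve-∀

   B₀-cong : ∀ {x y z w x′ y′ z′ w′} → x ≈ x′ → y ≈ y′ → z ≈ z′ → w ≈ w′ → B₀ x y z w ≈ᴮ B₀ x′ y′ z′ w′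
   B₀-cong x≈ y≈ z≈ w≈ = onBPos λ i j _ →
     +-cong (*-cong x≈ ≈-refl) (+-cong (*-cong y≈ ≈-refl) (+-cong (*-cong z≈ ≈-refl) (*-cong w≈ ≈-refl)))

  drop-zero : ∀ x y → + 0 + x + y ≡ x + y
  drop-zero = solve-∀

  lift : ℤ → ℤ → ℤ → ℤ → Mat n
  lift w w′ z z′ = X Id (comb₂ w i₂ w′ i₃) (comb₂ z n₃ z′ n₂)

  liftConjugate : ℤ → ℤ → ℤ → ℤ → Mat n
  liftConjugate w w′ z z′ = Y Id (comb₂ w i₂ w′ i₃) (comb₂ z n₃ z′ n₂)

  lift-image : ∀ w w′ z z′ → lift w w′ z z′ ≈ᴮ B₀ w (w * a₂ + w′) z z′
  lift-image w w′ z z′ = onBPos λ i j ij → ≡⇒≈ (begin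
    δ i j + δ zero i * (comb₂ w i₂ w′ i₃ ᵥ⊗ G) j + (z * δ n₃ i + z′ * δ n₂ i) * δ iₙ j
      ≡⟨ cong₂ (λ x y → x + y + (z * δ n₃ i + z′ * δ n₂ i) * δ iₙ j) (BPos-δ i j ij) (row-at-BPos (uG-low w w′) i j ij) ⟩
    + 0 + δ zero i * (w * δ i₂ j + (w * a₂ + w′) * δ i₃ j) + (z * δ n₃ i + z′ * δ n₂ i) * δ iₙ j
      ≡⟨ drop-zero (δ zero i * (w * δ i₂ j + (w * a₂ + w′) * δ i₃ j)) ((z * δ n₃ i + z′ * δ n₂ i) * δ iₙ j) ⟩
    δ zero i * (w * δ i₂ j + (w * a₂ + w′) * δ i₃ j) + (z * δ n₃ i + z′ * δ n₂ i) * δ iₙ j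
      ≡⟨ B₀-entry w (w * a₂ + w′) z z′ i j ⟨
    B₀ w (w * a₂ + w′) z z′ i j ∎)
    where open ≡-Reasoning

  liftConjugate-image : ∀ w w′ z z′ → liftConjugate w w′ z z′ ≈ᴮ B₀ w w′ (z + z′ * aₙ) z′
  liftConjugate-image w w′ z z′ = onBPos λ i j ij → ≡⇒≈ (begin
    δ i j + δ zero i * (w * δ i₂ j + w′ * δ i₃ j) + (G ⊗ᵥ comb₂ z n₃ z′ n₂) i * δ iₙ j
      ≡⟨ cong₂ (λ x y → x + δ zero i * (w * δ i₂ j + w′ * δ i₃ j) + y) (BPos-δ i j ij) (col-at-BPos (Gv-high z z′) i j ij) ⟩
    + 0 + δ zero i * (w * δ i₂ j + w′ * δ i₃ j) + ((z + z′ * aₙ) * δ n₃ i + z′ * δ n₂ i) * δ iₙ j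
      ≡⟨ drop-zero (δ zero i * (w * δ i₂ j + w′ * δ i₃ j)) (((z + z′ * aₙ) * δ n₃ i + z′ * δ n₂ i) * δ iₙ j) ⟩
    δ zero i * (w * δ i₂ j + w′ * δ i₃ j) + ((z + z′ * aₙ) * δ n₃ i + z′ * δ n₂ i) * δ iₙ j
      ≡⟨ B₀-entry w w′ (z + z′ * aₙ) z′ i j ⟨
    B₀ w w′ (z + z′ * aₙ) z′ i j ∎)
    where open ≡-Reasoning

  Id-commutes : Id ⊗ G ≐ G ⊗ Id
  Id-commutes i j = trans (⊗-identityˡ G i j) (sym (⊗-identityʳ G i j))

  comb-zeros : ∀ w {x} w′ {y} → x ≡ + 0 → y ≡ + 0 → w * x + w′ * y ≡ + 0
  comb-zeros w w′ refl refl = zeros w w′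
    where
    zeros : ∀ w w′ → w * + 0 + w′ * + 0 ≡ + 0
    zeros = solve-∀

  lift-U¹ : ∀ w w′ z z′ → AgreesWithId 1 (lift w w′ z z′)
  lift-U¹ w w′ z z′ =
    +B-agreesWithId (+B-agreesWithId (Id-agreesWithId 1) (e₀⊙-zeroUpTo uG≡0)) (⊙eₙ-zeroUpTo v≡0)
    where
    uG≡0 : ∀ j → toℕ j ℕ.≤ 1 → (comb₂ w i₂ w′ i₃ ᵥ⊗ G) j ≡ + 0
    uG≡0 j j≤1 = trans (uG-low w w′ j (ℕ.≤-trans j≤1 (ℕ.s≤s ℕ.z≤n)))
      (comb-zeros w (w * a₂ + w′) (δ-below (ℕ.s≤s j≤1)) (δ-below (ℕ.s≤s (ℕ.m≤n⇒m≤1+n j≤1))))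
    v≡0 : ∀ i → n ℕ.≤ 1 ℕ.+ toℕ i → z * δ n₃ i + z′ * δ n₂ i ≡ + 0
    v≡0 i n≤1+i = comb-zeros z z′
      (δ-above (subst (ℕ._< toℕ i) (sym toℕ-n₃) (ℕ.<-trans (ℕ.n<1+n k) k+1<i)))
      (δ-above (subst (ℕ._< toℕ i) (sym toℕ-n₂) k+1<i))
      where
      k+1<i : ℕ.suc k ℕ.< toℕ i
      k+1<i = ℕ.≤-pred n≤1+i

  liftConjugate-U : ∀ w w′ z z′ → AgreesWithId 0 (liftConjugate w w′ z z′)
  liftConjugate-U w w′ z z′ =
    +B-agreesWithId (+B-agreesWithId (Id-agreesWithId 0) (e₀⊙-zeroUpTo u≡0)) (⊙eₙ-zeroUpTo Gv≡0)
    where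
    u≡0 : ∀ j → toℕ j ℕ.≤ 0 → w * δ i₂ j + w′ * δ i₃ j ≡ + 0
    u≡0 zero _ = comb-zeros w w′ refl refl
    Gv≡0 : ∀ i → n ℕ.≤ 0 ℕ.+ toℕ i → (G ⊗ᵥ comb₂ z n₃ z′ n₂) i ≡ + 0
    Gv≡0 i n≤i = trans (Gv-high z z′ i (ℕ.≤-trans n≤i (ℕ.m≤n+m (toℕ i) 3)))
      (comb-zeros (z + z′ * aₙ) z′
        (δ-above (subst (ℕ._< toℕ i) (sym toℕ-n₃) (ℕ.≤-trans (ℕ.m≤n+m (ℕ.suc k) 2) n≤i)))
        (δ-above (subst (ℕ._< toℕ i) (sym toℕ-n₂) (ℕ.≤-trans (ℕ.m≤n+m (ℕ.suc (ℕ.suc k)) 1) n≤i))))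

  lift-intertwines : ∀ w w′ z z′ → liftConjugate w w′ z z′ ⊗ G ≐ G ⊗ lift w w′ z z′
  lift-intertwines w w′ z z′ = Y-intertwines Id (comb₂ w i₂ w′ i₃) (comb₂ z n₃ z′ n₂) Id-commutes

  -- The row-0 coefficient c₂ - c₁ a₂ makes the lift map to b.
  σ-constraint : ∀ {b} c₁ c₂ c₃ c₄ → b ≈ᴮ B₀ c₁ c₂ c₃ c₄ → InBσ p g b →
                 B₀ c₁ (c₂ - c₁ * a₂) (c₃ + c₄ * aₙ) c₄ ≈ᴮ B₀ c₁ c₂ c₃ c₄
  σ-constraint {b} c₁ c₂ c₃ c₄ b≈B₀ bσ = begin
    B₀ c₁ w′ (c₃ + c₄ * aₙ) c₄ ≈⟨ ≈ᴮ-sym (liftConjugate-image c₁ w′ c₃ c₄) ⟩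
    liftConjugate c₁ w′ c₃ c₄  ≈⟨ fromDefsᴮ {liftConjugate c₁ w′ c₃ c₄} {b} σ-lift≈b ⟩
    b                          ≈⟨ b≈B₀ ⟩
    B₀ c₁ c₂ c₃ c₄             ∎
    where
    open ≈ᴮ-Reasoning
    w′ : ℤ
    w′ = c₂ - c₁ * a₂
    cancel : ∀ c₁ c₂ a → c₁ * a + (c₂ - c₁ * a) ≡ c₂
    cancel = solve-∀
    lift≈b : lift c₁ w′ c₃ c₄ ≈ᴮ b
    lift≈b = begin
      lift c₁ w′ c₃ c₄                 ≈⟨ lift-image c₁ w′ c₃ c₄ ⟩
      B₀ c₁ (c₁ * a₂ + w′) c₃ c₄       ≈⟨ B₀-cong ≈-refl (≡⇒≈ (cancel c₁ c₂ a₂)) ≈-refl ≈-refl ⟩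
      B₀ c₁ c₂ c₃ c₄                   ≈⟨ ≈ᴮ-sym b≈B₀ ⟩
      b                                ∎
    σ-lift≈b : liftConjugate c₁ w′ c₃ c₄ ≈B[ p ] b
    σ-lift≈b = bσ (lift c₁ w′ c₃ c₄) (liftConjugate c₁ w′ c₃ c₄)
      (agreesWithId⇒InU¹ p (lift-U¹ c₁ w′ c₃ c₄)) (toDefsᴮ lift≈b)
      (λ i j → toDefs (intertwines-mod {lift c₁ w′ c₃ c₄} {liftConjugate c₁ w′ c₃ c₄}
                                        (lift-intertwines c₁ w′ c₃ c₄) i j))

  S : Mat n
  S i j with toℕ j ℕ.≟ ℕ.suc (toℕ i)
  ... | yes _ = M i j
  ... | no  _ = + 0

  S-off : ∀ {i j} → toℕ j ≢ ℕ.suc (toℕ i) → S i j ≡ + 0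
  S-off {i} {j} j≢1+i with toℕ j ℕ.≟ ℕ.suc (toℕ i)
  ... | yes j≡1+i = ⊥-elim (j≢1+i j≡1+i)
  ... | no  _     = refl

  M≡S-near : ∀ i j → toℕ j ℕ.≤ 1 ℕ.+ toℕ i → M i j ≡ S i j
  M≡S-near i j j≤1+i with toℕ j ℕ.≟ ℕ.suc (toℕ i)
  ... | yes _     = refl
  ... | no  j≢1+i = M-strict i j (ℕ.≤-pred (ℕ.≤∧≢⇒< j≤1+i j≢1+i))

  S-column : ∀ {a b} → toℕ b ≡ ℕ.suc (toℕ a) → ∀ i → S i b ≡ M a b * δ a i
  S-column {a} {b} b≡1+a i with i Data.Fin.≟ a
  ... | yes refl = trans (sym (M≡S-near a b (ℕ.≤-reflexive b≡1+a)))
                         (sym (trans (cong (M a b *_) (δ-refl a)) (ℤ.*-identityʳ (M a b))))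
  ... | no  i≢a  = trans (S-off (λ b≡1+i → i≢a (Fin.toℕ-injective (ℕ.suc-injective (trans (sym b≡1+i) b≡1+a)))))
                         (sym (trans (cong (M a b *_) (δ-≢ (i≢a ∘ sym))) (ℤ.*-zeroʳ (M a b))))

  S-row : ∀ {a b} → toℕ b ≡ ℕ.suc (toℕ a) → ∀ j → S a j ≡ M a b * δ b j
  S-row {a} {b} b≡1+a j with j Data.Fin.≟ b
  ... | yes refl = trans (sym (M≡S-near a j (ℕ.≤-reflexive b≡1+a)))
                         (sym (trans (cong (M a j *_) (δ-refl j)) (ℤ.*-identityʳ (M a j))))
  ... | no  j≢b  = trans (S-off (λ j≡1+a → j≢b (Fin.toℕ-injective (trans j≡1+a (sym b≡1+a)))))
                         (sym (trans (cong (M a b *_) (δ-≢ (j≢b ∘ sym))) (ℤ.*-zeroʳ (M a b))))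

  -- G = h + D with h ∈ U¹: D keeps the superdiagonal of G and adds e at (a , b).
  D : ℤ → Fin (ℕ.suc n) → Fin (ℕ.suc n) → Mat n
  D e a b = S +B e ·B (δ a ⊙ δ b)

  conjugator : ℤ → Fin (ℕ.suc n) → Fin (ℕ.suc n) → Mat n
  conjugator e a b i j = G i j - D e a b i j

  conjugator-U¹ : ∀ e {a b} → 2 ℕ.+ toℕ a ℕ.≤ toℕ b → AgreesWithId 1 (conjugator e a b)
  conjugator-U¹ e {a} {b} a+2≤b i j j≤1+i = begin
    δ i j + M i j - (S i j + e * (δ a i * δ b j))
      ≡⟨ cong₂ (λ x y → δ i j + x - (S i j + e * y)) (M≡S-near i j j≤1+i) unit≡0 ⟩
    δ i j + S i j - (S i j + e * + 0)             ≡⟨ cancel (δ i j) (S i j) e ⟩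
    δ i j                                          ∎
    where
    open ≡-Reasoning
    cancel : ∀ x s e → x + s - (s + e * + 0) ≡ x
    cancel = solve-∀
    unit≡0 : δ a i * δ b j ≡ + 0
    unit≡0 with a Data.Fin.≟ i
    ... | yes refl = trans (cong (δ a a *_) (δ-below (ℕ.≤-trans (ℕ.s≤s j≤1+i) a+2≤b))) (ℤ.*-zeroʳ (δ a a))
    ... | no  a≢i  = trans (cong (_* δ b j) (δ-≢ a≢i)) (ℤ.*-zeroˡ (δ b j))

  lift-conjugation : ∀ u v {h D : Mat n} → AgreesWithId 0 h → G ≐ h +B D →
    (∀ i j → δ zero i * (u ᵥ⊗ D) j ≈ (D ⊗ᵥ v) i * δ iₙ j) →
    ∀ i j → (h ⊗ X Id u v) i j ≈ (Y Id u v ⊗ h) i j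
  lift-conjugation u v {h} {D} h∈U G≐h+D defect≈0 i j = begin
    (h ⊗ X Id u v) i j
      ≡⟨ ⊗-X h Id u v i j ⟩
    (h ⊗ Id) i j + (h ⊗ᵥ δ zero) i * (u ᵥ⊗ G) j + (h ⊗ᵥ v) i * δ iₙ j
      ≡⟨ cong₃ (λ x y z → x + y * z + (h ⊗ᵥ v) i * δ iₙ j) (⊗-identityʳ h i j) (column-zero h∈U i) uG≡uh+uD ⟩
    h i j + δ zero i * ((u ᵥ⊗ h) j + (u ᵥ⊗ D) j) + (h ⊗ᵥ v) i * δ iₙ j
      ≡⟨ regroupˡ (h i j) (δ zero i) ((u ᵥ⊗ h) j) ((u ᵥ⊗ D) j) ((h ⊗ᵥ v) i * δ iₙ j) ⟩
    h i j + δ zero i * (u ᵥ⊗ h) j + (h ⊗ᵥ v) i * δ iₙ j + δ zero i * (u ᵥ⊗ D) j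
      ≈⟨ +-cong (≈-refl {h i j + δ zero i * (u ᵥ⊗ h) j + (h ⊗ᵥ v) i * δ iₙ j}) (defect≈0 i j) ⟩
    h i j + δ zero i * (u ᵥ⊗ h) j + (h ⊗ᵥ v) i * δ iₙ j + (D ⊗ᵥ v) i * δ iₙ j
      ≡⟨ regroupʳ (h i j) (δ zero i * (u ᵥ⊗ h) j) ((h ⊗ᵥ v) i) ((D ⊗ᵥ v) i) (δ iₙ j) ⟩
    h i j + δ zero i * (u ᵥ⊗ h) j + ((h ⊗ᵥ v) i + (D ⊗ᵥ v) i) * δ iₙ j
      ≡⟨ cong₃ (λ x y z → x + δ zero i * (u ᵥ⊗ h) j + y * z) (⊗-identityˡ h i j) Gv≡hv+Dv (row-last h∈U j) ⟨
    (Id ⊗ h) i j + δ zero i * (u ᵥ⊗ h) j + (G ⊗ᵥ v) i * (δ iₙ ᵥ⊗ h) j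
      ≡⟨ Y-⊗ Id u v h i j ⟨
    (Y Id u v ⊗ h) i j ∎
    where
    open ≈-Reasoning
    uG≡uh+uD : (u ᵥ⊗ G) j ≡ (u ᵥ⊗ h) j + (u ᵥ⊗ D) j
    uG≡uh+uD = trans (ᵥ⊗-cong u G≐h+D j) (ᵥ⊗-distrib-+B u h D j)
    Gv≡hv+Dv : (G ⊗ᵥ v) i ≡ (h ⊗ᵥ v) i + (D ⊗ᵥ v) i
    Gv≡hv+Dv = trans (⊗ᵥ-cong v G≐h+D i) (⊗ᵥ-distrib-+B h D v i)
    regroupˡ : ∀ x d a b c → x + d * (a + b) + c ≡ x + d * a + c + d * b
    regroupˡ = solve-∀
    regroupʳ : ∀ x y a b f → x + y + a * f + b * f ≡ x + y + (a + b) * f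
    regroupʳ = solve-∀

  lift-InGenFixed : ∀ w w′ z z′ e {a b} → 2 ℕ.+ toℕ a ℕ.≤ toℕ b →
    (∀ i j → δ zero i * (comb₂ w i₂ w′ i₃ ᵥ⊗ D e a b) j ≈ (D e a b ⊗ᵥ comb₂ z n₃ z′ n₂) i * δ iₙ j) →
    InGenFixed p g (lift w w′ z z′)
  lift-InGenFixed w w′ z z′ e {a} {b} a+2≤b defect≈0 =
    conjugation⇒InGenFixed (lift-U¹ w w′ z z′) (liftConjugate-U w w′ z z′) (conjugator-U¹ e a+2≤b)
      (lift-intertwines w w′ z z′)
      (lift-conjugation (comb₂ w i₂ w′ i₃) (comb₂ z n₃ z′ n₂) (agreesWithId-weaken (conjugator-U¹ e a+2≤b))
        (λ i j → restore (G i j) (D e a b i j)) defect≈0)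
    where
    restore : ∀ x y → x ≡ x - y + y
    restore = solve-∀

  M² : Mat n
  M² = M ⊗ M

  M²-zeroUpTo : ZeroUpTo 1 M²
  M²-zeroUpTo = ⊗-zeroUpTo M-strict M-strict

  X₁ : Mat n
  X₁ = Id +B M²

  X₁-U¹ : AgreesWithId 1 X₁
  X₁-U¹ = +B-agreesWithId (Id-agreesWithId 1) M²-zeroUpTo

  X₁-commutes : X₁ ⊗ G ≐ G ⊗ X₁
  X₁-commutes i j = begin
    (X₁ ⊗ G) i j                             ≡⟨ Id+-⊗-Id+ M² M i j ⟩
    δ i j + M i j + (M² i j + (M² ⊗ M) i j)  ≡⟨ cong (λ x → δ i j + M i j + (M² i j + x)) (⊗-assoc M M M i j) ⟩
    δ i j + M i j + (M² i j + (M ⊗ M²) i j)  ≡⟨ swap (δ i j) (M i j) (M² i j) ((M ⊗ M²) i j) ⟩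
    δ i j + M² i j + (M i j + (M ⊗ M²) i j)  ≡⟨ Id+-⊗-Id+ M M² i j ⟨
    (G ⊗ X₁) i j                             ∎
    where
    open ≡-Reasoning
    swap : ∀ x a b c → x + a + (b + c) ≡ x + b + (a + c)
    swap = solve-∀

  X₁-InGenFixed : InGenFixed p g X₁
  X₁-InGenFixed = conjugation⇒InGenFixed X₁-U¹ (agreesWithId-weaken X₁-U¹) (Id-agreesWithId 1) X₁-commutes
    (λ i j → ≡⇒≈ (trans (⊗-identityˡ X₁ i j) (sym (⊗-identityʳ X₁ i j))))

  negRow-ᵥ⊗G : ∀ a j → ((λ k → - M a k) ᵥ⊗ G) j ≡ - (M a j + M² a j)
  negRow-ᵥ⊗G a j = trans (negRow-ᵥ⊗ M a G j)
    (cong -_ (trans (⊗-distribˡ-+B M Id M a j) (cong (_+ M² a j) (⊗-identityʳ M a j))))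

  G⊗ᵥ-negColumn : ∀ i b → (G ⊗ᵥ (λ k → - M k b)) i ≡ - (M i b + M² i b)
  G⊗ᵥ-negColumn i b = trans (⊗ᵥ-negColumn G M b i)
    (cong -_ (trans (⊗-distribʳ-+B Id M M i b) (cong (_+ M² i b) (⊗-identityˡ M i b))))

  rowPoly : Mat n
  rowPoly = X X₁ (λ j → - M i₂ j) 0ᵥ

  rowPoly-InGenFixed : InGenFixed p g rowPoly
  rowPoly-InGenFixed = conjugation⇒InGenFixed rowPoly-U¹ image-U H-U¹
    (Y-intertwines X₁ m 0ᵥ X₁-commutes) (λ i j → ≡⇒≈ (conj i j))
    where
    m : Vector ℤ (ℕ.suc n)
    m j = - M i₂ j
    H : Mat n
    H = Id +B δ zero ⊙ δ i₂
    rowPoly-U¹ : AgreesWithId 1 rowPoly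
    rowPoly-U¹ = +B-agreesWithId (+B-agreesWithId X₁-U¹ (e₀⊙-zeroUpTo mG≡0)) (⊙eₙ-zeroUpTo (λ _ _ → refl))
      where
      mG≡0 : ∀ j → toℕ j ℕ.≤ 1 → (m ᵥ⊗ G) j ≡ + 0
      mG≡0 j j≤1 = trans (negRow-ᵥ⊗G i₂ j) (cong₂ (λ x y → - (x + y))
        (M-strict i₂ j (ℕ.m≤n⇒m≤1+n j≤1)) (M²-zeroUpTo i₂ j (ℕ.≤-trans j≤1 (ℕ.s≤s ℕ.z≤n))))
    image-U : AgreesWithId 0 (Y X₁ m 0ᵥ)
    image-U = +B-agreesWithId (+B-agreesWithId (agreesWithId-weaken X₁-U¹) (e₀⊙-zeroUpTo m≡0))
                              (⊙eₙ-zeroUpTo (λ i _ → ⊗ᵥ-0ᵥ G i))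
      where
      m≡0 : ∀ j → toℕ j ℕ.≤ 0 → m j ≡ + 0
      m≡0 j j≤0 = cong -_ (M-strict i₂ j (ℕ.≤-trans j≤0 ℕ.z≤n))
    H-U¹ : AgreesWithId 1 H
    H-U¹ = +B-agreesWithId (Id-agreesWithId 1) (e₀⊙-zeroUpTo (λ j j≤1 → δ-below (ℕ.s≤s j≤1)))
    conj : ∀ i j → (H ⊗ rowPoly) i j ≡ (Y X₁ m 0ᵥ ⊗ H) i j
    conj i j = begin
      (H ⊗ rowPoly) i j
        ≡⟨ +⊙-⊗ Id (δ zero) (δ i₂) rowPoly i j ⟩
      (Id ⊗ rowPoly) i j + δ zero i * (δ i₂ ᵥ⊗ rowPoly) j
        ≡⟨ cong₂ (λ x y → x + δ zero i * y) (⊗-identityˡ rowPoly i j) (δ-ᵥ⊗ i₂ rowPoly j) ⟩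
      X₁ i j + δ zero i * (m ᵥ⊗ G) j + + 0 * δ iₙ j
        + δ zero i * (δ i₂ j + M² i₂ j + + 0 * (m ᵥ⊗ G) j + + 0 * δ iₙ j)
        ≡⟨ cong (λ x → X₁ i j + δ zero i * x + + 0 * δ iₙ j
                        + δ zero i * (δ i₂ j + M² i₂ j + + 0 * (m ᵥ⊗ G) j + + 0 * δ iₙ j)) (negRow-ᵥ⊗G i₂ j) ⟩
      X₁ i j + δ zero i * - (M i₂ j + M² i₂ j) + + 0 * δ iₙ j
        + δ zero i * (δ i₂ j + M² i₂ j + + 0 * (m ᵥ⊗ G) j + + 0 * δ iₙ j)
        ≡⟨ simplify (X₁ i j) (δ zero i) (M i₂ j) (M² i₂ j) (δ i₂ j) ((m ᵥ⊗ G) j) (δ iₙ j) ⟩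
      X₁ i j + δ zero i * m j + + 0 * δ iₙ j + δ zero i * δ i₂ j
        ≡⟨ cong₂ (λ x y → X₁ i j + δ zero i * m j + x * δ iₙ j + y * δ i₂ j)
                 (⊗ᵥ-0ᵥ G i) (column-zero image-U i) ⟨
      Y X₁ m 0ᵥ i j + (Y X₁ m 0ᵥ ⊗ᵥ δ zero) i * δ i₂ j
        ≡⟨ cong (_+ (Y X₁ m 0ᵥ ⊗ᵥ δ zero) i * δ i₂ j) (⊗-identityʳ (Y X₁ m 0ᵥ) i j) ⟨
      (Y X₁ m 0ᵥ ⊗ Id) i j + (Y X₁ m 0ᵥ ⊗ᵥ δ zero) i * δ i₂ j
        ≡⟨ ⊗-+⊙ (Y X₁ m 0ᵥ) Id (δ zero) (δ i₂) i j ⟨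
      (Y X₁ m 0ᵥ ⊗ H) i j ∎
      where
      open ≡-Reasoning
      simplify : ∀ x d a q e r f →
        x + d * - (a + q) + + 0 * f + d * (e + q + + 0 * r + + 0 * f) ≡ x + d * - a + + 0 * f + d * e
      simplify = solve-∀

  colPoly : Mat n
  colPoly = X X₁ 0ᵥ (λ i → - M i n₂)

  colPoly-InGenFixed : InGenFixed p g colPoly
  colPoly-InGenFixed = conjugation⇒InGenFixed colPoly-U¹ image-U H-U¹
    (Y-intertwines X₁ 0ᵥ c X₁-commutes) (λ i j → ≡⇒≈ (conj i j))
    where
    c : Vector ℤ (ℕ.suc n)
    c i = - M i n₂
    H : Mat n
    H = Id +B δ n₂ ⊙ δ iₙ
    n₂<i : ∀ {i} → n ℕ.≤ 1 ℕ.+ toℕ i → toℕ n₂ ℕ.< toℕ i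
    n₂<i {i} n≤1+i = subst (ℕ._< toℕ i) (sym toℕ-n₂) (ℕ.≤-pred n≤1+i)
    colPoly-U¹ : AgreesWithId 1 colPoly
    colPoly-U¹ = +B-agreesWithId (+B-agreesWithId X₁-U¹ (e₀⊙-zeroUpTo (λ j _ → 0ᵥ-ᵥ⊗ G j))) (⊙eₙ-zeroUpTo c≡0)
      where
      c≡0 : ∀ i → n ℕ.≤ 1 ℕ.+ toℕ i → c i ≡ + 0
      c≡0 i n≤1+i = cong -_ (M-strict i n₂ (ℕ.<⇒≤ (n₂<i n≤1+i)))
    image-U : AgreesWithId 0 (Y X₁ 0ᵥ c)
    image-U = +B-agreesWithId (+B-agreesWithId (agreesWithId-weaken X₁-U¹) (e₀⊙-zeroUpTo (λ _ _ → refl)))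
                              (⊙eₙ-zeroUpTo Gc≡0)
      where
      Gc≡0 : ∀ i → n ℕ.≤ 0 ℕ.+ toℕ i → (G ⊗ᵥ c) i ≡ + 0
      Gc≡0 i n≤i = trans (G⊗ᵥ-negColumn i n₂) (cong₂ (λ x y → - (x + y))
        (M-strict i n₂ n₂≤i) (M²-zeroUpTo i n₂ (ℕ.m≤n⇒m≤1+n n₂≤i)))
        where
        n₂≤i : toℕ n₂ ℕ.≤ toℕ i
        n₂≤i = ℕ.<⇒≤ (n₂<i (ℕ.m≤n⇒m≤1+n n≤i))
    H-U¹ : AgreesWithId 1 H
    H-U¹ = +B-agreesWithId (Id-agreesWithId 1) (⊙eₙ-zeroUpTo (λ i n≤1+i → δ-above (n₂<i n≤1+i)))
    conj : ∀ i j → (H ⊗ colPoly) i j ≡ (Y X₁ 0ᵥ c ⊗ H) i j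
    conj i j = begin
      (H ⊗ colPoly) i j
        ≡⟨ +⊙-⊗ Id (δ n₂) (δ iₙ) colPoly i j ⟩
      (Id ⊗ colPoly) i j + δ n₂ i * (δ iₙ ᵥ⊗ colPoly) j
        ≡⟨ cong₂ (λ x y → x + δ n₂ i * y) (⊗-identityˡ colPoly i j) (row-last (agreesWithId-weaken colPoly-U¹) j) ⟩
      X₁ i j + δ zero i * (0ᵥ ᵥ⊗ G) j + c i * δ iₙ j + δ n₂ i * δ iₙ j
        ≡⟨ cong₂ (λ x y → X₁ i j + δ zero i * x + c i * δ iₙ j + y * δ iₙ j) (0ᵥ-ᵥ⊗ G j) (δ-comm n₂ i) ⟩
      X₁ i j + δ zero i * + 0 + c i * δ iₙ j + δ i n₂ * δ iₙ j
        ≡⟨ simplify (X₁ i j) (δ zero i) (M i n₂) (M² i n₂) (δ i n₂) ((G ⊗ᵥ c) i) (δ iₙ j) ⟩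
      X₁ i j + δ zero i * + 0 + - (M i n₂ + M² i n₂) * δ iₙ j
        + (δ i n₂ + M² i n₂ + δ zero i * + 0 + (G ⊗ᵥ c) i * + 0) * δ iₙ j
        ≡⟨ cong₂ (λ x y → X₁ i j + δ zero i * + 0 + x * δ iₙ j
                          + (δ i n₂ + M² i n₂ + δ zero i * + 0 + (G ⊗ᵥ c) i * y) * δ iₙ j)
                 (G⊗ᵥ-negColumn i n₂) (δ-below n₂<iₙ) ⟨
      Y X₁ 0ᵥ c i j + Y X₁ 0ᵥ c i n₂ * δ iₙ j
        ≡⟨ cong₂ (λ x y → x + y * δ iₙ j) (⊗-identityʳ (Y X₁ 0ᵥ c) i j) (⊗ᵥ-δ (Y X₁ 0ᵥ c) n₂ i) ⟨
      (Y X₁ 0ᵥ c ⊗ Id) i j + (Y X₁ 0ᵥ c ⊗ᵥ δ n₂) i * δ iₙ j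
        ≡⟨ ⊗-+⊙ (Y X₁ 0ᵥ c) Id (δ n₂) (δ iₙ) i j ⟨
      (Y X₁ 0ᵥ c ⊗ H) i j ∎
      where
      open ≡-Reasoning
      simplify : ∀ x d a q e r f →
        x + d * + 0 + - a * f + e * f ≡ x + d * + 0 + - (a + q) * f + (e + q + d * + 0 + r * + 0) * f
      simplify = solve-∀

  rowPoly-image : X₁ +B (- + 1) ·B rowPoly ≈ᴮ B₀ (+ 0) a₂ (+ 0) (+ 0)
  rowPoly-image = onBPos λ i j ij → ≡⇒≈ (begin
    X₁ i j + - + 1 * (X₁ i j + δ zero i * (m ᵥ⊗ G) j + + 0 * δ iₙ j)
      ≡⟨ cong (λ x → X₁ i j + - + 1 * (X₁ i j + x + + 0 * δ iₙ j)) (row-at-BPos mG-low i j ij) ⟩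
    X₁ i j + - + 1 * (X₁ i j + δ zero i * - (a₂ * δ i₃ j) + + 0 * δ iₙ j)
      ≡⟨ simplify (X₁ i j) (δ zero i) a₂ (δ i₂ j) (δ i₃ j) (δ n₃ i) (δ n₂ i) (δ iₙ j) ⟩
    δ zero i * (+ 0 * δ i₂ j + a₂ * δ i₃ j) + (+ 0 * δ n₃ i + + 0 * δ n₂ i) * δ iₙ j
      ≡⟨ B₀-entry (+ 0) a₂ (+ 0) (+ 0) i j ⟨
    B₀ (+ 0) a₂ (+ 0) (+ 0) i j ∎)
    where
    open ≡-Reasoning
    m : Vector ℤ (ℕ.suc n)
    m j = - M i₂ j
    mG-low : ∀ j → toℕ j ℕ.≤ 3 → (m ᵥ⊗ G) j ≡ - (a₂ * δ i₃ j)
    mG-low j j≤3 = trans (negRow-ᵥ⊗G i₂ j)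
      (trans (cong₂ (λ x y → - (x + y)) (M-row₂ j j≤3) (M²-zeroUpTo i₂ j j≤3)) (cong -_ (ℤ.+-identityʳ (a₂ * δ i₃ j))))
    simplify : ∀ x d a e₂ e₃ y₃ y₂ f →
      x + - + 1 * (x + d * - (a * e₃) + + 0 * f) ≡ d * (+ 0 * e₂ + a * e₃) + (+ 0 * y₃ + + 0 * y₂) * f
    simplify = solve-∀

  colPoly-image : X₁ +B (- + 1) ·B colPoly ≈ᴮ B₀ (+ 0) (+ 0) aₙ (+ 0)
  colPoly-image = onBPos λ i j ij → ≡⇒≈ (begin
    X₁ i j + - + 1 * (X₁ i j + δ zero i * (0ᵥ ᵥ⊗ G) j + - M i n₂ * δ iₙ j)
      ≡⟨ cong₂ (λ x y → X₁ i j + - + 1 * (X₁ i j + δ zero i * x + y)) (0ᵥ-ᵥ⊗ G j)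
               (col-at-BPos {λ i → - M i n₂} {λ i → - (aₙ * δ n₃ i)} (λ i n≤3+i → cong -_ (M-col₂ i n≤3+i)) i j ij) ⟩
    X₁ i j + - + 1 * (X₁ i j + δ zero i * + 0 + - (aₙ * δ n₃ i) * δ iₙ j)
      ≡⟨ simplify (X₁ i j) (δ zero i) aₙ (δ i₂ j) (δ i₃ j) (δ n₃ i) (δ n₂ i) (δ iₙ j) ⟩
    δ zero i * (+ 0 * δ i₂ j + + 0 * δ i₃ j) + (aₙ * δ n₃ i + + 0 * δ n₂ i) * δ iₙ j
      ≡⟨ B₀-entry (+ 0) (+ 0) aₙ (+ 0) i j ⟨
    B₀ (+ 0) (+ 0) aₙ (+ 0) i j ∎)
    where
    open ≡-Reasoning
    simplify : ∀ x d a e₂ e₃ y₃ y₂ f →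
      x + - + 1 * (x + d * + 0 + - (a * y₃) * f) ≡ d * (+ 0 * e₂ + + 0 * e₃) + (a * y₃ + + 0 * y₂) * f
    simplify = solve-∀

  B₀-combination : ∀ α β {x y κ₁ κ₂ κ₃ κ₄ λ₁ λ₂ λ₃ λ₄} →
    x ≈ᴮ B₀ κ₁ κ₂ κ₃ κ₄ → y ≈ᴮ B₀ λ₁ λ₂ λ₃ λ₄ →
    α ·B x +B β ·B y ≈ᴮ B₀ (α * κ₁ + β * λ₁) (α * κ₂ + β * λ₂) (α * κ₃ + β * λ₃) (α * κ₄ + β * λ₄)
  B₀-combination α β {κ₁ = κ₁} {κ₂} {κ₃} {κ₄} {λ₁} {λ₂} {λ₃} {λ₄} x≈ y≈ = onBPos λ i j ij →
    ≈-trans (+-cong (*-cong (≈-refl {α}) (at x≈ i j ij)) (*-cong (≈-refl {β}) (at y≈ i j ij)))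
            (≡⇒≈ (trans (cong₂ _+_ (B₀-·B α κ₁ κ₂ κ₃ κ₄ i j) (B₀-·B β λ₁ λ₂ λ₃ λ₄ i j))
                        (B₀-+B (α * κ₁) (α * κ₂) (α * κ₃) (α * κ₄) (β * λ₁) (β * λ₂) (β * λ₃) (β * λ₄) i j)))

  rowPoly-difference : InGenFixed p g (B₀ (+ 0) a₂ (+ 0) (+ 0))
  rowPoly-difference = InGenFixed-respects (≈ᴮ-sym rowPoly-image)
    (InGenFixed-+B {X₁} { - + 1 ·B rowPoly} X₁-InGenFixed (InGenFixed-·B (- + 1) {rowPoly} rowPoly-InGenFixed))

  colPoly-difference : InGenFixed p g (B₀ (+ 0) (+ 0) aₙ (+ 0))
  colPoly-difference = InGenFixed-respects (≈ᴮ-sym colPoly-image)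
    (InGenFixed-+B {X₁} { - + 1 ·B colPoly} X₁-InGenFixed (InGenFixed-·B (- + 1) {colPoly} colPoly-InGenFixed))

-- n ≥ 4

module Case≥4 (p k : ℕ) (prime : Prime p) (g : Mat (4 ℕ.+ k)) (gU : InU p g) where
  open Modular p
  open BEquality p {4 ℕ.+ k}
  open Generated p g
  open FixedClasses p (ℕ.suc k) g gU

  private
    n : ℕ
    n = 4 ℕ.+ k

  i₄ n₄ : Fin (ℕ.suc n)
  i₄ = suc (suc (suc (suc zero)))
  n₄ = fromℕ< (ℕ.m<n+m k {5} ℕ.z<s)

  toℕ-n₄ : toℕ n₄ ≡ k
  toℕ-n₄ = Fin.toℕ-fromℕ< (ℕ.m<n+m k {5} ℕ.z<s)

  a₃ a₄ : ℤ
  a₃ = M i₃ i₄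
  a₄ = M n₄ n₃

  B₀-at-03 : ∀ x y z w → B₀ x y z w zero i₃ ≡ y
  B₀-at-03 x y z w = trans (B₀-entry x y z w zero i₃) (read x y z w)
    where
    read : ∀ x y z w → + 1 * (x * + 0 + y * + 1) + (z * + 0 + w * + 0) * + 0 ≡ y
    read = solve-∀

  B₀-at-n₃n : ∀ x y z w → B₀ x y z w n₃ iₙ ≡ z
  B₀-at-n₃n x y z w = begin
    B₀ x y z w n₃ iₙ
      ≡⟨ B₀-entry x y z w n₃ iₙ ⟩
    + 0 * (x * δ i₂ iₙ + y * δ i₃ iₙ) + (z * δ n₃ n₃ + w * δ n₂ n₃) * δ iₙ iₙ
      ≡⟨ cong₃ (λ a b c → + 0 * (x * δ i₂ iₙ + y * δ i₃ iₙ) + (z * a + w * b) * c)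
               (δ-refl n₃) (δ-below n₃<n₂) (δ-refl iₙ) ⟩
    + 0 * (x * δ i₂ iₙ + y * δ i₃ iₙ) + (z * + 1 + w * + 0) * + 1
      ≡⟨ read x y z w (δ i₂ iₙ) (δ i₃ iₙ) ⟩
    z ∎
    where
    open ≡-Reasoning
    read : ∀ x y z w d e → + 0 * (x * d + y * e) + (z * + 1 + w * + 0) * + 1 ≡ z
    read = solve-∀

  BPos-03 : BPos {n} zero i₃
  BPos-03 = ℕ.s≤s (ℕ.s≤s ℕ.z≤n) , ℕ.≤-refl

  BPos-n₃n : BPos n₃ iₙ
  BPos-n₃n = subst₂ (λ a c → 2 ℕ.+ a ℕ.≤ c) (sym toℕ-n₃) (sym toℕ-iₙ) (ℕ.n≤1+n _)
           , subst₂ (λ a c → c ℕ.≤ 3 ℕ.+ a) (sym toℕ-n₃) (sym toℕ-iₙ) ℕ.≤-refl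

  σ-fixed-coordinates : ∀ {b} c₁ c₂ c₃ c₄ → b ≈ᴮ B₀ c₁ c₂ c₃ c₄ → InBσ p g b → c₁ * a₂ ≈ + 0 × c₄ * aₙ ≈ + 0
  σ-fixed-coordinates c₁ c₂ c₃ c₄ b≈B₀ bσ =
      -‿≈0 (+-cancel-≈0 c₂ (≈-transport (B₀-at-03 c₁ _ _ c₄) (B₀-at-03 c₁ c₂ c₃ c₄) (at image≈ zero i₃ BPos-03)))
    , +-cancel-≈0 c₃ (≈-transport (B₀-at-n₃n c₁ _ _ c₄) (B₀-at-n₃n c₁ c₂ c₃ c₄) (at image≈ n₃ iₙ BPos-n₃n))
    where
    image≈ : B₀ c₁ (c₂ - c₁ * a₂) (c₃ + c₄ * aₙ) c₄ ≈ᴮ B₀ c₁ c₂ c₃ c₄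
    image≈ = σ-constraint c₁ c₂ c₃ c₄ b≈B₀ bσ

  row-defect : ∀ w′ → a₂ ≈ + 0 → ∀ i j →
    δ zero i * (comb₂ (+ 1) i₂ w′ i₃ ᵥ⊗ D (- (w′ * a₃)) i₂ i₄) j
      ≈ (D (- (w′ * a₃)) i₂ i₄ ⊗ᵥ comb₂ (+ 0) n₃ (+ 0) n₂) i * δ iₙ j
  row-defect w′ a₂≈0 i j = begin
    δ zero i * (comb₂ (+ 1) i₂ w′ i₃ ᵥ⊗ Dₑ) j
      ≡⟨ cong (δ zero i *_) (trans (comb₂-ᵥ⊗ (+ 1) i₂ w′ i₃ Dₑ j)
           (cong₂ (λ x y → + 1 * (x + e * (+ 1 * δ i₄ j)) + w′ * (y + e * (+ 0 * δ i₄ j)))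
                  (S-row {i₂} {i₃} refl j) (S-row {i₃} {i₄} refl j))) ⟩
    δ zero i * (+ 1 * (a₂ * δ i₃ j + e * (+ 1 * δ i₄ j)) + w′ * (a₃ * δ i₄ j + e * (+ 0 * δ i₄ j)))
      ≡⟨ cancel (δ zero i) a₂ a₃ w′ (δ i₃ j) (δ i₄ j) ⟩
    δ zero i * (a₂ * δ i₃ j)
      ≈⟨ *-cong (≈-refl {δ zero i}) (*-cong a₂≈0 (≈-refl {δ i₃ j})) ⟩
    δ zero i * (+ 0 * δ i₃ j)
      ≡⟨ ℤ.*-zeroʳ (δ zero i) ⟩
    + 0
      ≡⟨ vanish (D e i₂ i₄ i n₃) (D e i₂ i₄ i n₂) (δ iₙ j) ⟨
    (+ 0 * Dₑ i n₃ + + 0 * Dₑ i n₂) * δ iₙ j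
      ≡⟨ cong (_* δ iₙ j) (⊗ᵥ-comb₂ Dₑ (+ 0) n₃ (+ 0) n₂ i) ⟨
    (Dₑ ⊗ᵥ comb₂ (+ 0) n₃ (+ 0) n₂) i * δ iₙ j ∎
    where
    open ≈-Reasoning
    e : ℤ
    e = - (w′ * a₃)
    Dₑ : Mat n
    Dₑ = D e i₂ i₄
    cancel : ∀ d a₂ a₃ w′ x y →
      d * (+ 1 * (a₂ * x + - (w′ * a₃) * (+ 1 * y)) + w′ * (a₃ * y + - (w′ * a₃) * (+ 0 * y))) ≡ d * (a₂ * x)
    cancel = solve-∀
    vanish : ∀ x y f → (+ 0 * x + + 0 * y) * f ≡ + 0
    vanish = solve-∀

  col-defect : ∀ z → aₙ ≈ + 0 → ∀ i j →
    δ zero i * (comb₂ (+ 0) i₂ (+ 0) i₃ ᵥ⊗ D (- (z * a₄)) n₄ n₂) j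
      ≈ (D (- (z * a₄)) n₄ n₂ ⊗ᵥ comb₂ z n₃ (+ 1) n₂) i * δ iₙ j
  col-defect z aₙ≈0 i j = begin
    δ zero i * (comb₂ (+ 0) i₂ (+ 0) i₃ ᵥ⊗ Dₑ) j
      ≡⟨ cong (δ zero i *_) (comb₂-ᵥ⊗ (+ 0) i₂ (+ 0) i₃ Dₑ j) ⟩
    δ zero i * (+ 0 * Dₑ i₂ j + + 0 * Dₑ i₃ j)
      ≡⟨ vanish (δ zero i) (Dₑ i₂ j) (Dₑ i₃ j) ⟩
    + 0
      ≡⟨ ℤ.*-zeroˡ (δ iₙ j) ⟨
    + 0 * δ iₙ j
      ≈⟨ *-cong (≈-sym (*-cong aₙ≈0 (≈-refl {δ n₃ i}))) (≈-refl {δ iₙ j}) ⟩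
    aₙ * δ n₃ i * δ iₙ j
      ≡⟨ cong (_* δ iₙ j) (cancel z a₄ aₙ (δ n₄ i) (δ n₃ i)) ⟨
    (z * (a₄ * δ n₄ i + e * (δ n₄ i * + 0)) + + 1 * (aₙ * δ n₃ i + e * (δ n₄ i * + 1))) * δ iₙ j
      ≡⟨ cong₂ (λ x y → (z * (a₄ * δ n₄ i + e * (δ n₄ i * x)) + + 1 * (aₙ * δ n₃ i + e * (δ n₄ i * y))) * δ iₙ j)
               (δ-below n₃<n₂) (δ-refl n₂) ⟨
    (z * (a₄ * δ n₄ i + e * (δ n₄ i * δ n₂ n₃)) + + 1 * (aₙ * δ n₃ i + e * (δ n₄ i * δ n₂ n₂))) * δ iₙ j
      ≡⟨ cong₂ (λ x y → (z * (x + e * (δ n₄ i * δ n₂ n₃)) + + 1 * (y + e * (δ n₄ i * δ n₂ n₂))) * δ iₙ j)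
               (S-column n₃≡1+n₄ i) (S-column toℕ-n₂′ i) ⟨
    (z * Dₑ i n₃ + + 1 * Dₑ i n₂) * δ iₙ j
      ≡⟨ cong (_* δ iₙ j) (⊗ᵥ-comb₂ Dₑ z n₃ (+ 1) n₂ i) ⟨
    (Dₑ ⊗ᵥ comb₂ z n₃ (+ 1) n₂) i * δ iₙ j ∎
    where
    open ≈-Reasoning
    e : ℤ
    e = - (z * a₄)
    Dₑ : Mat n
    Dₑ = D e n₄ n₂
    n₃≡1+n₄ : toℕ n₃ ≡ ℕ.suc (toℕ n₄)
    n₃≡1+n₄ = trans toℕ-n₃ (cong ℕ.suc (sym toℕ-n₄))
    toℕ-n₂′ : toℕ n₂ ≡ ℕ.suc (toℕ n₃)
    toℕ-n₂′ = trans toℕ-n₂ (cong ℕ.suc (sym toℕ-n₃))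
    vanish : ∀ d x y → d * (+ 0 * x + + 0 * y) ≡ + 0
    vanish = solve-∀
    cancel : ∀ z a₄ aₙ x y → z * (a₄ * x + - (z * a₄) * (x * + 0)) + + 1 * (aₙ * y + - (z * a₄) * (x * + 1)) ≡ aₙ * y
    cancel = solve-∀

  rowPart : ∀ c₁ c₂ → c₁ * a₂ ≈ + 0 → Dec (+ p ℤ∣.∣ a₂) → InGenFixed p g (B₀ c₁ c₂ (+ 0) (+ 0))
  rowPart c₁ c₂ c₁a₂≈0 (yes p∣a₂) = InGenFixed-respects (≈ᴮ-sym combination≈)
          (InGenFixed-+B {+ 1 ·B lift (+ 1) c₂ (+ 0) (+ 0)} {(c₁ - + 1) ·B lift (+ 1) (+ 0) (+ 0) (+ 0)}
            (InGenFixed-·B (+ 1) {lift (+ 1) c₂ (+ 0) (+ 0)} (row-lift c₂))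
            (InGenFixed-·B (c₁ - + 1) {lift (+ 1) (+ 0) (+ 0) (+ 0)} (row-lift (+ 0))))
    where
    a₂≈0 : a₂ ≈ + 0
    a₂≈0 = divisible⇒≈0 p∣a₂
    row-lift : ∀ w′ → InGenFixed p g (lift (+ 1) w′ (+ 0) (+ 0))
    row-lift w′ = lift-InGenFixed (+ 1) w′ (+ 0) (+ 0) (- (w′ * a₃)) {i₂} {i₄} ℕ.≤-refl (row-defect w′ a₂≈0)
    combination≈ : + 1 ·B lift (+ 1) c₂ (+ 0) (+ 0) +B (c₁ - + 1) ·B lift (+ 1) (+ 0) (+ 0) (+ 0)
                   ≈ᴮ B₀ c₁ c₂ (+ 0) (+ 0)
    combination≈ = ≈ᴮ-trans
      (B₀-combination (+ 1) (c₁ - + 1) (lift-image (+ 1) c₂ (+ 0) (+ 0)) (lift-image (+ 1) (+ 0) (+ 0) (+ 0)))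
      (B₀-cong (≡⇒≈ (first c₁)) second≈ (≡⇒≈ (third c₁)) (≡⇒≈ (third c₁)))
      where
      first : ∀ c₁ → + 1 * + 1 + (c₁ - + 1) * + 1 ≡ c₁
      first = solve-∀
      second : ∀ c₁ c₂ a → + 1 * (+ 1 * a + c₂) + (c₁ - + 1) * (+ 1 * a + + 0) ≡ c₂ + c₁ * a
      second = solve-∀
      third : ∀ c₁ → + 1 * + 0 + (c₁ - + 1) * + 0 ≡ + 0
      third = solve-∀
      drop : ∀ c₁ c₂ → c₂ + c₁ * + 0 ≡ c₂
      drop = solve-∀
      second≈ : + 1 * (+ 1 * a₂ + c₂) + (c₁ - + 1) * (+ 1 * a₂ + + 0) ≈ c₂
      second≈ = ≈-trans (≡⇒≈ (second c₁ c₂ a₂))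
                (≈-trans (+-cong (≈-refl {c₂}) (*-cong (≈-refl {c₁}) a₂≈0)) (≡⇒≈ (drop c₁ c₂)))
  rowPart c₁ c₂ c₁a₂≈0 (no p∤a₂) =
    InGenFixed-respects scaled≈ (InGenFixed-·B (c₂ * u) {B₀ (+ 0) a₂ (+ 0) (+ 0)} rowPoly-difference)
    where
    u : ℤ
    u = proj₁ (inverse prime p∤a₂)
    ua₂≈1 : u * a₂ ≈ + 1
    ua₂≈1 = proj₂ (inverse prime p∤a₂)
    c₁≈0 : c₁ ≈ + 0
    c₁≈0 = ≈0-cancel {c₁} {a₂} {u} c₁a₂≈0 ua₂≈1
    scaled≈ : B₀ c₁ c₂ (+ 0) (+ 0) ≈ᴮ c₂ * u ·B B₀ (+ 0) a₂ (+ 0) (+ 0)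
    scaled≈ = ≈ᴮ-trans
      (B₀-cong (≈-trans c₁≈0 (0≈*0 (c₂ * u))) (≈-rescale c₂ ua₂≈1) (0≈*0 (c₂ * u)) (0≈*0 (c₂ * u)))
      (≐⇒≈ᴮ (λ i j → sym (B₀-·B (c₂ * u) (+ 0) a₂ (+ 0) (+ 0) i j)))

  colPart : ∀ c₃ c₄ → c₄ * aₙ ≈ + 0 → Dec (+ p ℤ∣.∣ aₙ) → InGenFixed p g (B₀ (+ 0) (+ 0) c₃ c₄)
  colPart c₃ c₄ c₄aₙ≈0 (yes p∣aₙ) = InGenFixed-respects (≈ᴮ-sym combination≈)
          (InGenFixed-+B {+ 1 ·B lift (+ 0) (+ 0) c₃ (+ 1)} {(c₄ - + 1) ·B lift (+ 0) (+ 0) (+ 0) (+ 1)}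
            (InGenFixed-·B (+ 1) {lift (+ 0) (+ 0) c₃ (+ 1)} (col-lift c₃))
            (InGenFixed-·B (c₄ - + 1) {lift (+ 0) (+ 0) (+ 0) (+ 1)} (col-lift (+ 0))))
    where
    col-lift : ∀ z → InGenFixed p g (lift (+ 0) (+ 0) z (+ 1))
    col-lift z =
      lift-InGenFixed (+ 0) (+ 0) z (+ 1) (- (z * a₄)) {n₄} {n₂} n₄+2≤n₂ (col-defect z (divisible⇒≈0 p∣aₙ))
      where
      n₄+2≤n₂ : 2 ℕ.+ toℕ n₄ ℕ.≤ toℕ n₂
      n₄+2≤n₂ = ℕ.≤-reflexive (trans (cong (2 ℕ.+_) toℕ-n₄) (sym toℕ-n₂))
    combination≈ : + 1 ·B lift (+ 0) (+ 0) c₃ (+ 1) +B (c₄ - + 1) ·B lift (+ 0) (+ 0) (+ 0) (+ 1)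
                   ≈ᴮ B₀ (+ 0) (+ 0) c₃ c₄
    combination≈ = ≈ᴮ-trans
      (B₀-combination (+ 1) (c₄ - + 1) (lift-image (+ 0) (+ 0) c₃ (+ 1)) (lift-image (+ 0) (+ 0) (+ 0) (+ 1)))
      (B₀-cong (≡⇒≈ (first c₄)) (≡⇒≈ (second c₄ a₂)) (≡⇒≈ (third c₃ c₄)) (≡⇒≈ (fourth c₄)))
      where
      first : ∀ c₄ → + 1 * + 0 + (c₄ - + 1) * + 0 ≡ + 0
      first = solve-∀
      second : ∀ c₄ a → + 1 * (+ 0 * a + + 0) + (c₄ - + 1) * (+ 0 * a + + 0) ≡ + 0
      second = solve-∀
      third : ∀ c₃ c₄ → + 1 * c₃ + (c₄ - + 1) * + 0 ≡ c₃
      third = solve-∀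
      fourth : ∀ c₄ → + 1 * + 1 + (c₄ - + 1) * + 1 ≡ c₄
      fourth = solve-∀
  colPart c₃ c₄ c₄aₙ≈0 (no p∤aₙ) =
    InGenFixed-respects scaled≈ (InGenFixed-·B (c₃ * u) {B₀ (+ 0) (+ 0) aₙ (+ 0)} colPoly-difference)
    where
    u : ℤ
    u = proj₁ (inverse prime p∤aₙ)
    uaₙ≈1 : u * aₙ ≈ + 1
    uaₙ≈1 = proj₂ (inverse prime p∤aₙ)
    c₄≈0 : c₄ ≈ + 0
    c₄≈0 = ≈0-cancel {c₄} {aₙ} {u} c₄aₙ≈0 uaₙ≈1
    scaled≈ : B₀ (+ 0) (+ 0) c₃ c₄ ≈ᴮ c₃ * u ·B B₀ (+ 0) (+ 0) aₙ (+ 0)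
    scaled≈ = ≈ᴮ-trans
      (B₀-cong (0≈*0 (c₃ * u)) (0≈*0 (c₃ * u)) (≈-rescale c₃ uaₙ≈1) (≈-trans c₄≈0 (0≈*0 (c₃ * u))))
      (≐⇒≈ᴮ (λ i j → sym (B₀-·B (c₃ * u) (+ 0) (+ 0) aₙ (+ 0) i j)))


  generated : ∀ b → InB0 p n b → InBσ p g b → InGenFixed p g b
  generated b b∈B₀ bσ with InB0⇒B₀ b∈B₀
  ... | c₁ , c₂ , c₃ , c₄ , b≈B₀ = InGenFixed-respects split
          (InGenFixed-+B {B₀ c₁ c₂ (+ 0) (+ 0)} {B₀ (+ 0) (+ 0) c₃ c₄}
            (rowPart c₁ c₂ (proj₁ constraints) (+ p ℤ∣.∣? a₂))
            (colPart c₃ c₄ (proj₂ constraints) (+ p ℤ∣.∣? aₙ)))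
    where
    constraints : c₁ * a₂ ≈ + 0 × c₄ * aₙ ≈ + 0
    constraints = σ-fixed-coordinates c₁ c₂ c₃ c₄ b≈B₀ bσ
    split : b ≈ᴮ B₀ c₁ c₂ (+ 0) (+ 0) +B B₀ (+ 0) (+ 0) c₃ c₄
    split = ≈ᴮ-trans b≈B₀ (≈ᴮ-trans
      (B₀-cong (≡⇒≈ (sym (ℤ.+-identityʳ c₁))) (≡⇒≈ (sym (ℤ.+-identityʳ c₂)))
               (≡⇒≈ (sym (ℤ.+-identityˡ c₃))) (≡⇒≈ (sym (ℤ.+-identityˡ c₄))))
      (≐⇒≈ᴮ (λ i j → sym (B₀-+B c₁ c₂ (+ 0) (+ 0) (+ 0) (+ 0) c₃ c₄ i j))))

-- n = 3

module Case3 (p : ℕ) (g : Mat 3) (gU : InU p g) where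
  open Modular p
  open BEquality p {3}
  open Generated p g
  open FixedClasses p 0 g gU

  B₀-at-03 : ∀ x y z w → B₀ x y z w zero i₃ ≡ y + z
  B₀-at-03 x y z w = trans (B₀-entry x y z w zero i₃) (read x y z w)
    where
    read : ∀ x y z w → + 1 * (x * + 0 + y * + 1) + (z * + 1 + w * + 0) * + 1 ≡ y + z
    read = solve-∀

  σ-fixed-coordinates : ∀ {b} c₁ c₂ c₃ c₄ → b ≈ᴮ B₀ c₁ c₂ c₃ c₄ → InBσ p g b → c₄ * aₙ ≈ c₁ * a₂
  σ-fixed-coordinates c₁ c₂ c₃ c₄ b≈B₀ bσ = difference≈0 (+-cancel-≈0 (c₂ + c₃)
    (≈-transport (trans (B₀-at-03 c₁ _ _ c₄) (regroup c₁ c₂ c₃ c₄ a₂ aₙ)) (B₀-at-03 c₁ c₂ c₃ c₄)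
                 (at (σ-constraint c₁ c₂ c₃ c₄ b≈B₀ bσ) zero i₃ (ℕ.s≤s (ℕ.s≤s ℕ.z≤n) , ℕ.≤-refl))))
    where
    regroup : ∀ c₁ c₂ c₃ c₄ a₂ aₙ → c₂ - c₁ * a₂ + (c₃ + c₄ * aₙ) ≡ c₂ + c₃ + (c₄ * aₙ - c₁ * a₂)
    regroup = solve-∀

  -- With n = 3 the two ends of B₀ overlap at ē₀₃, so b is the image of a single lift.
  generated : ∀ b → InB0 p 3 b → InBσ p g b → InGenFixed p g b
  generated b b∈B₀ bσ with InB0⇒B₀ b∈B₀
  ... | c₁ , c₂ , c₃ , c₄ , b≈B₀ =
    InGenFixed-respects b≈lift (lift-InGenFixed c₁ w′ c₃ c₄ (+ 0) {zero} {i₂} ℕ.≤-refl defect≈0)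
    where
    w′ : ℤ
    w′ = c₂ - c₁ * a₂
    cancel : ∀ c₁ c₂ a → c₂ ≡ c₁ * a + (c₂ - c₁ * a)
    cancel = solve-∀
    b≈lift : b ≈ᴮ lift c₁ w′ c₃ c₄
    b≈lift = ≈ᴮ-trans b≈B₀ (≈ᴮ-trans (B₀-cong ≈-refl (≡⇒≈ (cancel c₁ c₂ a₂)) ≈-refl ≈-refl)
                                      (≈ᴮ-sym (lift-image c₁ w′ c₃ c₄)))
    D₀ : Mat 3
    D₀ = D (+ 0) zero i₂
    defect≈0 : ∀ i j → δ zero i * (comb₂ c₁ i₂ w′ i₃ ᵥ⊗ D₀) j ≈ (D₀ ⊗ᵥ comb₂ c₃ zero c₄ (suc zero)) i * δ i₃ j
    defect≈0 i j = begin
      δ zero i * (comb₂ c₁ i₂ w′ i₃ ᵥ⊗ D₀) j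
        ≡⟨ cong (δ zero i *_) (trans (comb₂-ᵥ⊗ c₁ i₂ w′ i₃ D₀ j)
             (cong₂ (λ x y → c₁ * (x + + 0 * (+ 0 * δ i₂ j)) + w′ * (y + + 0 * (+ 0 * δ i₂ j)))
                    (S-row {i₂} {i₃} refl j) (S-off (λ j≡4 → ℕ.<-irrefl j≡4 (Fin.toℕ<n j))))) ⟩
      δ zero i * (c₁ * (a₂ * δ i₃ j + + 0 * (+ 0 * δ i₂ j)) + w′ * (+ 0 + + 0 * (+ 0 * δ i₂ j)))
        ≡⟨ rowSide (δ zero i) c₁ a₂ w′ (δ i₃ j) (δ i₂ j) ⟩
      c₁ * a₂ * (δ zero i * δ i₃ j)
        ≈⟨ *-cong (≈-sym key) (≈-refl {δ zero i * δ i₃ j}) ⟩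
      c₄ * aₙ * (δ zero i * δ i₃ j)
        ≡⟨ colSide c₃ c₄ aₙ (δ zero i) (δ i₃ j) ⟨
      (c₃ * (+ 0 + + 0 * (δ zero i * + 0)) + c₄ * (aₙ * δ zero i + + 0 * (δ zero i * + 0))) * δ i₃ j
        ≡⟨ cong₂ (λ x y → (c₃ * (x + + 0 * (δ zero i * + 0)) + c₄ * (y + + 0 * (δ zero i * + 0))) * δ i₃ j)
                 (S-off {i} {zero} (λ ())) (S-column {zero} {suc zero} refl i) ⟨
      (c₃ * D₀ i zero + c₄ * D₀ i (suc zero)) * δ i₃ j
        ≡⟨ cong (_* δ i₃ j) (⊗ᵥ-comb₂ D₀ c₃ zero c₄ (suc zero) i) ⟨
      (D₀ ⊗ᵥ comb₂ c₃ zero c₄ (suc zero)) i * δ i₃ j ∎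
      where
      open ≈-Reasoning
      key : c₄ * aₙ ≈ c₁ * a₂
      key = σ-fixed-coordinates c₁ c₂ c₃ c₄ b≈B₀ bσ
      rowSide : ∀ d c₁ a₂ w′ x y → d * (c₁ * (a₂ * x + + 0 * (+ 0 * y)) + w′ * (+ 0 + + 0 * (+ 0 * y))) ≡ c₁ * a₂ * (d * x)
      rowSide = solve-∀
      colSide : ∀ c₃ c₄ aₙ d x → (c₃ * (+ 0 + + 0 * (d * + 0)) + c₄ * (aₙ * d + + 0 * (d * + 0))) * x ≡ c₄ * aₙ * (d * x)
      colSide = solve-∀

lemma4p12 : (p n : ℕ) → Prime p → 3 ≤ n →
    (g : Mat n) → InU p g →
    (b : Mat n) → InB0 p n b → InBσ p g b → InGenFixed p g b
lemma4p12 p _ p-prime (ℕ.s≤s (ℕ.s≤s (ℕ.s≤s (ℕ.z≤n {ℕ.zero})))) g gU = Case3.generated p g gU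
lemma4p12 p _ p-prime (ℕ.s≤s (ℕ.s≤s (ℕ.s≤s (ℕ.z≤n {ℕ.suc k})))) g gU = Case≥4.generated p k p-prime g gU
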